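{- Let $q$ be a prime power, $t$ a positive integer, $n=2t$, $\xi\in\mathbb{F}_{q^n}\setminus\mathbb{F}_{q^t}$, $f\in\mathcal{L}_{t,q}$ and $L=L_{S_{f,\xi}\times S_{f,\xi}}$. For $\alpha\in\mathbb{F}_{q^n}^*$, the point $\langle(1,\alpha)\rangle_{\mathbb{F}_{q^n}}$ has weight in $L$ at most $3\dim_{\mathbb{F}_q}(\mathrm{Im}(f))$ if $\alpha\notin\mathbb{F}_{q^t}$; exactly $\dim_{\mathbb{F}_q}\ker\big(f(\frac1\alpha X)-\frac1\alpha f(X)\big)$ if $\alpha\in\mathbb{F}_{q^t}\setminus\mathbb{F}_q$; and exactly $t$ if $\alpha\in\mathbb{F}_q^*$.
   Context: $\mathcal{L}_{t,q}$ is the set of $\mathbb{F}_q$-linearised polynomials $\sum_{i=0}^{t-1}c_iX^{q^i}$, $c_i\in\mathbb{F}_{q^t}$, viewed as $\mathbb{F}_q$-linear maps of $\mathbb{F}_{q^t}$ (kernels and images in $\mathbb{F}_{q^t}$). For such $h$ and $\zeta\in\mathbb{F}_{q^{2t}}\setminus\mathbb{F}_{q^t}$, $S_{h,\zeta}=\{u+\zeta h(u):u\in\mathbb{F}_{q^t}\}$. For an $\mathbb{F}_q$-subspace $U$ of $\mathbb{F}_{q^n}^2$, $L_U=\{\langle u\rangle_{\mathbb{F}_{q^n}}: u\in U\setminus\{0\}\}$ and the weight of a point $\langle v\rangle_{\mathbb{F}_{q^n}}$ is $\dim_{\mathbb{F}_q}(U\cap\langle v\rangle_{\mathbb{F}_{q^n}})$.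 $S\times T=\{(s,t):s\in S,t\in T\}$. -}

module Defs where

open import Level using (0ℓ)
open import Data.Nat as ℕ using (ℕ; zero; suc)
open import Data.Nat.Primality using (Prime)
open import Data.Fin using (Fin)
open import Data.List using (List; length)
open import Data.List.Membership.Propositional using (_∈_)
open import Data.List.Relation.Unary.Unique.Propositional using (Unique)
open import Data.Product using (Σ; ∃; _×_; _,_)
open import Relation.Nullary using (¬_)
open import Relation.Binary.PropositionalEquality using (_≡_)
open import Relation.Binary.Definitions using (DecidableEquality)
open import Algebra.Structures using (IsCommutativeRing)

IsPrimePower : ℕ → Set
IsPrimePower q = Σ ℕ λ p → Σ ℕ λ k → Prime p × q ≡ p ℕ.^ suc k

record FiniteField : Set₁ where
  infixl 6 _+_ _-_
  infixl 7 _*_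
  field
    Carrier   : Set
    _+_ _*_   : Carrier → Carrier → Carrier
    -_        : Carrier → Carrier
    0# 1#     : Carrier
    _⁻¹       : Carrier → Carrier
    isCommutativeRing : IsCommutativeRing _≡_ _+_ _*_ -_ 0# 1#
    0≢1       : ¬ (0# ≡ 1#)
    inverseʳ  : ∀ x → ¬ (x ≡ 0#) → x * (x ⁻¹) ≡ 1#
    _≟_       : DecidableEquality Carrier
    elements  : List Carrier
    complete  : ∀ x → x ∈ elements
    unique    : Unique elements

  size : ℕ
  size = length elements

  _-_ : Carrier → Carrier → Carrier
  x - y = x + (- y)

  pow : Carrier → ℕ → Carrier
  pow x zero    = 1#
  pow x (suc m) = x * pow x m

  sumF : (k : ℕ) → (Fin k → Carrier) → Carrier
  sumF zero    g = 0#
  sumF (suc k) g = g Fin.zero + sumF k (λ i → g (Fin.suc i))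
    where import Data.Fin as Fin

module _ (K : FiniteField) where
  open FiniteField K

  -- x ∈ F_m, the subfield of elements fixed by x ↦ x^m (m = q^e gives F_{q^e})
  InSub : ℕ → Carrier → Set
  InSub m x = pow x m ≡ x

  linPoly : (q t : ℕ) → (Fin t → Carrier) → Carrier → Carrier
  linPoly q t c u = sumF t (λ i → c i * pow u (q ℕ.^ Data.Fin.toℕ i))

  -- Dimension over F_q of an F_q-subspace P of an F_q-vector space V
  -- (V a K-module, scalars restricted to F_q): P has a basis of size k.
  module _ (q : ℕ) {V : Set} (_⊕_ : V → V → V) (o : V) (_·_ : Carrier → V → V) where

    lincomb : (k : ℕ) → (Fin k → Carrier) → (Fin k → V) → V
    lincomb zero    λs b = o
    lincomb (suc k) λs b =
      (λs Data.Fin.zero · b Data.Fin.zero) ⊕ lincomb k (λ i → λs (Data.Fin.suc i)) (λ i → b (Data.Fin.suc i))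

    HasDim : (V → Set) → ℕ → Set
    HasDim P k = Σ (Fin k → V) λ b →
        (∀ i → P (b i))
      × (∀ (λs : Fin k → Carrier) → (∀ i → InSub q (λs i)) →
           lincomb k λs b ≡ o → ∀ i → λs i ≡ 0#)
      × (∀ x → P x → Σ (Fin k → Carrier) λ λs →
           (∀ i → InSub q (λs i)) × x ≡ lincomb k λs b)

  DimK : ℕ → (Carrier → Set) → ℕ → Set
  DimK q = HasDim q _+_ 0# _*_

  DimK² : ℕ → (Carrier × Carrier → Set) → ℕ → Set
  DimK² q = HasDim q (λ { (a , b) (c , d) → (a + c , b + d) }) (0# , 0#)
                     (λ { l (a , b) → (l * a , l * b) })

  S : (q t : ℕ) → (Carrier → Carrier) → Carrier → Carrier → Set
  S q t h ζ x = Σ Carrier λ u → InSub (q ℕ.^ t) u × x ≡ u + ζ * h u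

  -- (S×S) ∩ ⟨(1,α)⟩_{F_{q^n}}, whose F_q-dimension is the weight of ⟨(1,α)⟩ in L_{S×S}
  WeightSpace : (q t : ℕ) → (Carrier → Carrier) → Carrier → Carrier → Carrier × Carrier → Set
  WeightSpace q t h ζ α (x , y) =
    S q t h ζ x × S q t h ζ y × Σ Carrier (λ λ' → x ≡ λ' × y ≡ λ' * α)

  Im : (q t : ℕ) → (Carrier → Carrier) → Carrier → Set
  Im q t h y = Σ Carrier λ u → InSub (q ℕ.^ t) u × y ≡ h u

  KerTwist : (q t : ℕ) → (Carrier → Carrier) → Carrier → Carrier → Set
  KerTwist q t h β u = InSub (q ℕ.^ t) u × h (β * u) - β * h u ≡ 0#

module Submission where

-- Everything is counted. K has characteristic p, so x ↦ x^q is additive, and an F_q-subspace of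
-- dimension k has q^k elements because F_q = {x | x^q = x} has exactly q elements: at most q as
-- roots of X^q − X, and at least q since the trace K → F_q is additive with at most q^(2t−1)
-- zeros (it is monic of that degree), so q^(2t) ≤ |F_q| · q^(2t−1). With F = F_(q^t) we have
-- K = F ⊕ ξF, so every point of S_{f,ξ} is s u = u + ξ f(u) for a unique u ∈ F. For α ∈ F_q,
-- u ↦ (s u , s u · α) is a bijection from F onto the weight space W; for α ∈ F^*, z ↦ (s (z/α) , s z)
-- is a bijection from ker(f(X/α) − f(X)/α) onto W; for α ∉ F, (x , y) ↦ (f(u_x) , f(u_y)) injects W
-- into Im f × Im f, so the weight is even at most 2 dim Im f.

open import Defs
open import Level using (0ℓ)
open import Data.Nat as ℕ using (ℕ; zero; suc; _≤_; _<_; _!; z≤n; s≤s)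
import Data.Nat.Properties as ℕ
open import Data.Nat.Divisibility using (_∣_; divides; ∣⇒≤; ∣1⇒≡1; m∣m*n)
open import Data.Nat.Primality using (Prime; euclidsLemma; prime⇒nonTrivial)
open import Data.Nat.Combinatorics using (_C_; nCn≡1; k![n∸k]!∣n!)
open import Data.Nat.Combinatorics.Specification using (nCk≡n!/k![n-k]!)
open import Data.Nat.DivMod using (m/n*n≡m)
open import Data.Fin as Fin using (Fin; toℕ; fromℕ; inject₁)
import Data.Fin.Properties as Fin
open import Data.Product using (Σ; ∃; _×_; _,_; proj₁; proj₂; uncurry)
open import Data.Sum using (_⊎_; inj₁; inj₂)
open import Data.Unit using (⊤; tt)
open import Data.Maybe using (Maybe; just; nothing)
open import Data.List as List using (List; []; _∷_; length; map; filter; foldr; cartesianProduct)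
import Data.List.Properties as List
open import Data.List.Membership.Propositional using (_∈_; lose)
open import Data.List.Membership.Propositional.Properties
  using (∈-map⁺; ∈-map⁻; ∈-filter⁺; ∈-filter⁻; ∈-cartesianProduct⁺; ∈-cartesianProduct⁻; ∈-lookup)
open import Data.List.Membership.Propositional.Properties.WithK using (unique∧set⇒bag)
import Data.List.Membership.Setoid.Properties as SetoidMembership
open import Data.List.Relation.Unary.Any using (here; there; index; any?; satisfied)
import Data.List.Relation.Unary.All as All
open import Data.List.Relation.Unary.Unique.Propositional using (Unique; []; _∷_)
import Data.List.Relation.Unary.Unique.Propositional.Properties as Unique
open import Data.List.Relation.Binary.BagAndSetEquality using (∼bag⇒↭)
open import Data.List.Relation.Binary.Permutation.Propositional using (_↭_; ↭⇒↭ₛ)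
open import Data.List.Relation.Binary.Permutation.Propositional.Properties using (↭-length)
import Data.List.Relation.Binary.Permutation.Setoid.Properties as Permutation
open import Data.Vec as Vec using (Vec; []; _∷_)
import Data.Vec.Properties as Vec
open import Function.Bundles using (_⇔_; mk⇔)
open import Relation.Nullary using (¬_; ¬?; yes; no; contradiction)
open import Relation.Unary using (Pred; Decidable)
open import Relation.Binary.Definitions using (tri<; tri≈; tri>)
open import Relation.Binary.PropositionalEquality
open import Algebra.Bundles using (CommutativeRing; Ring; RawRing)
open import Algebra.Structures using (IsCommutativeMonoid)

-- The solver's coefficients are pairs (a , b) of naturals read as a − b; deciding
-- a + d ≟ c + b identifies (1 , 1) with (0 , 0), which is what lets it cancel x − x.
module CommutativeRingSolver {c ℓ} (R : CommutativeRing c ℓ) where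

  open import Algebra.Solver.Ring.AlmostCommutativeRing
    using (fromCommutativeRing; _-Raw-AlmostCommutative⟶_)
  import Algebra.Solver.Ring
  import Algebra.Properties.AbelianGroup as AbelianGroupProperties
  import Algebra.Properties.CommutativeSemigroup as CommutativeSemigroupProperties
  import Algebra.Properties.RingWithoutOne as RingWithoutOneProperties
  import Algebra.Properties.Semiring.Mult as SemiringMultProperties

  open CommutativeRing R hiding (refl; sym; trans; setoid)
  open CommutativeRing R using () renaming (sym to ≈-sym; trans to ≈-trans; setoid to ≈-setoid)
  open AbelianGroupProperties +-abelianGroup using (⁻¹-∙-comm; ⁻¹-anti-homo‿-)
  open CommutativeSemigroupProperties +-commutativeSemigroup using (interchange)
  open RingWithoutOneProperties (Ring.ringWithoutOne ring) using (x[y-z]≈xy-xz; [y-z]x≈yx-zx; -0#≈0#)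
  open SemiringMultProperties semiring renaming (_×_ to _·_) using (×-homo-+; ×1-homo-*)
  open import Relation.Binary.Reasoning.Setoid ≈-setoid

  private
    differences : RawRing 0ℓ 0ℓ
    differences = record
      { Carrier = ℕ × ℕ ; _≈_ = _≡_
      ; _+_ = λ { (a , b) (c , d) → (a ℕ.+ c , b ℕ.+ d) }
      ; _*_ = λ { (a , b) (c , d) → (a ℕ.* c ℕ.+ b ℕ.* d , a ℕ.* d ℕ.+ b ℕ.* c) }
      ; -_ = λ { (a , b) → (b , a) }
      ; 0# = (0 , 0) ; 1# = (1 , 0) }

    ⟦_⟧ : ℕ × ℕ → Carrier
    ⟦ a , b ⟧ = a · 1# - b · 1#

    sub-+-sub : ∀ x y z w → (x - y) + (z - w) ≈ (x + z) - (y + w)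
    sub-+-sub x y z w = ≈-trans (interchange x (- y) z (- w)) (+-congˡ (⁻¹-∙-comm y w))

    sub-sub : ∀ x y z w → (x - y) - (z - w) ≈ (x + w) - (y + z)
    sub-sub x y z w = ≈-trans (+-congˡ (⁻¹-anti-homo‿- z w)) (sub-+-sub x y w z)

    sub-cancel : ∀ x y z w → x + w ≈ z + y → x - y ≈ z - w
    sub-cancel x y z w eq = begin
      x - y                 ≈⟨ ≈-sym (+-identityʳ (x - y)) ⟩
      (x - y) + 0#          ≈⟨ +-congˡ (≈-sym (-‿inverseʳ w)) ⟩
      (x - y) + (w - w)     ≈⟨ sub-+-sub x y w w ⟩
      (x + w) - (y + w)     ≈⟨ +-cong eq (-‿cong (+-comm y w)) ⟩
      (z + y) - (w + y)     ≈⟨ sub-+-sub z w y y ⟨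
      (z - w) + (y - y)     ≈⟨ +-congˡ (-‿inverseʳ y) ⟩
      (z - w) + 0#          ≈⟨ +-identityʳ (z - w) ⟩
      z - w                 ∎

    ⟦⟧-+ : ∀ a b c d → ⟦ a ℕ.+ c , b ℕ.+ d ⟧ ≈ ⟦ a , b ⟧ + ⟦ c , d ⟧
    ⟦⟧-+ a b c d = ≈-trans (+-cong (×-homo-+ 1# a c) (-‿cong (×-homo-+ 1# b d))) (≈-sym (sub-+-sub _ _ _ _))

    ⟦⟧-* : ∀ a b c d → ⟦ a ℕ.* c ℕ.+ b ℕ.* d , a ℕ.* d ℕ.+ b ℕ.* c ⟧ ≈ ⟦ a , b ⟧ * ⟦ c , d ⟧
    ⟦⟧-* a b c d = begin
      ⟦ a ℕ.* c ℕ.+ b ℕ.* d , a ℕ.* d ℕ.+ b ℕ.* c ⟧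
        ≈⟨ +-cong (≈-trans (×-homo-+ 1# (a ℕ.* c) (b ℕ.* d)) (+-cong (×1-homo-* a c) (×1-homo-* b d)))
             (-‿cong (≈-trans (×-homo-+ 1# (a ℕ.* d) (b ℕ.* c)) (+-cong (×1-homo-* a d) (×1-homo-* b c)))) ⟩
      (x * z + y * w) - (x * w + y * z) ≈⟨ sub-sub (x * z) (x * w) (y * z) (y * w) ⟨
      (x * z - x * w) - (y * z - y * w) ≈⟨ +-cong (x[y-z]≈xy-xz x z w) (-‿cong (x[y-z]≈xy-xz y z w)) ⟨
      x * (z - w) - y * (z - w)         ≈⟨ [y-z]x≈yx-zx (z - w) x y ⟨
      (x - y) * (z - w)                 ∎
      where x = a · 1# ; y = b · 1# ; z = c · 1# ; w = d · 1#

    embedding : differences -Raw-AlmostCommutative⟶ fromCommutativeRing R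
    embedding = record
      { ⟦_⟧ = ⟦_⟧
      ; +-homo = λ { (a , b) (c , d) → ⟦⟧-+ a b c d }
      ; *-homo = λ { (a , b) (c , d) → ⟦⟧-* a b c d }
      ; -‿homo = λ { (a , b) → ≈-sym (⁻¹-anti-homo‿- (a · 1#) (b · 1#)) }
      ; 0-homo = -‿inverseʳ 0#
      ; 1-homo = ≈-trans (+-cong (+-identityʳ 1#) -0#≈0#) (+-identityʳ 1#)
      }

    coefficient≟ : ∀ x y → Maybe (⟦ x ⟧ ≈ ⟦ y ⟧)
    coefficient≟ (a , b) (c , d) with a ℕ.+ d ℕ.≟ c ℕ.+ b
    ... | yes a+d≡c+b = just (sub-cancel _ _ _ _ (begin
      a · 1# + d · 1# ≈⟨ ×-homo-+ 1# a d ⟨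
      (a ℕ.+ d) · 1#  ≡⟨ cong (_· 1#) a+d≡c+b ⟩
      (c ℕ.+ b) · 1#  ≈⟨ ×-homo-+ 1# c b ⟩
      c · 1# + b · 1# ∎))
    ... | no _        = nothing

  open Algebra.Solver.Ring differences (fromCommutativeRing R) embedding coefficient≟ public
    using (solve; _:=_; _:+_; _:*_; _:-_; :-_)

m^n≤m^o⇒n≤o : ∀ {m n o} → 1 < m → m ℕ.^ n ≤ m ℕ.^ o → n ≤ o
m^n≤m^o⇒n≤o {m} 1<m m^n≤m^o = ℕ.≮⇒≥ (λ o<n → ℕ.<⇒≱ (ℕ.^-monoʳ-< m 1<m o<n) m^n≤m^o)

m^n≡m^o⇒n≡o : ∀ {m n o} → 1 < m → m ℕ.^ n ≡ m ℕ.^ o → n ≡ o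
m^n≡m^o⇒n≡o 1<m eq = ℕ.≤-antisym (m^n≤m^o⇒n≤o 1<m (ℕ.≤-reflexive eq)) (m^n≤m^o⇒n≤o 1<m (ℕ.≤-reflexive (sym eq)))

m*m≡n*n⇒m≡n : ∀ {m n} → m ℕ.* m ≡ n ℕ.* n → m ≡ n
m*m≡n*n⇒m≡n {m} {n} eq with ℕ.<-cmp m n
... | tri< m<n _ _ = contradiction eq (ℕ.<⇒≢ (ℕ.*-mono-< m<n m<n))
... | tri≈ _ m≡n _ = m≡n
... | tri> _ _ n<m = contradiction (sym eq) (ℕ.<⇒≢ (ℕ.*-mono-< n<m n<m))

n∣n! : ∀ {n} → 0 < n → n ∣ n !
n∣n! {suc n} _ = m∣m*n (n !)

module _ {p : ℕ} (p-prime : Prime p) where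

  private
    1<p : 1 < p
    1<p = ℕ.nonTrivial⇒n>1 p {{prime⇒nonTrivial p-prime}}

  prime∤m! : ∀ {m} → m < p → ¬ p ∣ m !
  prime∤m! {zero}  m<p p∣1 = ℕ.<-irrefl (sym (∣1⇒≡1 p∣1)) 1<p
  prime∤m! {suc m} m<p p∣m! with euclidsLemma (suc m) (m !) p-prime p∣m!
  ... | inj₁ p∣1+m = ℕ.<⇒≱ m<p (∣⇒≤ p∣1+m)
  ... | inj₂ p∣m!  = prime∤m! (ℕ.<-trans (ℕ.n<1+n m) m<p) p∣m!

  prime∣binomial : ∀ {k} → 0 < k → k < p → p ∣ p C k
  prime∣binomial {k} 0<k k<p with euclidsLemma (p C k) (k ! ℕ.* (p ℕ.∸ k) !) p-prime p∣product
    where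
    instance _ = ℕ._!*_!≢0 k (p ℕ.∸ k)
    k≤p = ℕ.<⇒≤ k<p
    p∣product : p ∣ (p C k) ℕ.* (k ! ℕ.* (p ℕ.∸ k) !)
    p∣product = subst (p ∣_)
      (sym (trans (cong (ℕ._* (k ! ℕ.* (p ℕ.∸ k) !)) (nCk≡n!/k![n-k]! k≤p)) (m/n*n≡m (k![n∸k]!∣n! k≤p))))
      (n∣n! (ℕ.<-trans (s≤s z≤n) 1<p))
  ... | inj₁ p∣pCk  = p∣pCk
  ... | inj₂ p∣k!*r! with euclidsLemma (k !) ((p ℕ.∸ k) !) p-prime p∣k!*r!
  ...   | inj₁ p∣k! = contradiction p∣k! (prime∤m! k<p)
  ...   | inj₂ p∣r! = contradiction p∣r! (prime∤m! (ℕ.∸-monoʳ-< {p} {k} {0} 0<k (ℕ.<⇒≤ k<p)))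

module _ where

  private
    variable
      A B : Set
      m n : ℕ
      P : Pred A 0ℓ
      Q : Pred B 0ℓ

  unique∧same-members⇒↭ : ∀ {xs ys : List A} → Unique xs → Unique ys → (∀ {z} → z ∈ xs ⇔ z ∈ ys) → xs ↭ ys
  unique∧same-members⇒↭ u v eq = ∼bag⇒↭ (unique∧set⇒bag u v eq)

  foldr-unique-cong : ∀ {_∙_ : A → A → A} {ε : A} → IsCommutativeMonoid _≡_ _∙_ ε →
    ∀ {xs ys} → Unique xs → Unique ys → (∀ {z} → z ∈ xs ⇔ z ∈ ys) → foldr _∙_ ε xs ≡ foldr _∙_ ε ys
  foldr-unique-cong {A = A} isCM u v eq =
    Permutation.foldr-commMonoid (setoid A) isCM (↭⇒↭ₛ (unique∧same-members⇒↭ u v eq))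

  lookup-injective : ∀ {xs : List A} → Unique xs → ∀ {i j} → List.lookup xs i ≡ List.lookup xs j → i ≡ j
  lookup-injective {xs = _ ∷ _} _ {Fin.zero} {Fin.zero} _ = refl
  lookup-injective {xs = _ ∷ _} (x∉ ∷ _) {Fin.zero} {Fin.suc j} eq = contradiction eq (All.lookup x∉ (∈-lookup j))
  lookup-injective {xs = _ ∷ _} (x∉ ∷ _) {Fin.suc i} {Fin.zero} eq = contradiction (sym eq) (All.lookup x∉ (∈-lookup i))
  lookup-injective {xs = _ ∷ _} (_ ∷ u) {Fin.suc i} {Fin.suc j} eq = cong Fin.suc (lookup-injective u eq)

  unique-⊆⇒length≤ : ∀ {xs ys : List A} → Unique xs → (∀ {z} → z ∈ xs → z ∈ ys) → length xs ≤ length ys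
  unique-⊆⇒length≤ {A = A} {xs = xs} u xs⊆ys = Fin.injective⇒≤ {f = position} position-injective
    where
    position : Fin (length xs) → Fin _
    position i = index (xs⊆ys (∈-lookup i))
    position-injective : ∀ {i j} → position i ≡ position j → i ≡ j
    position-injective eq = lookup-injective u
      (SetoidMembership.index-injective (setoid A) (xs⊆ys (∈-lookup _)) (xs⊆ys (∈-lookup _)) eq)

  length-cartesianProduct : (xs : List A) (ys : List B) →
    length (cartesianProduct xs ys) ≡ length xs ℕ.* length ys
  length-cartesianProduct []       ys = refl
  length-cartesianProduct (x ∷ xs) ys = trans (List.length-++ (map (x ,_) ys))
    (cong₂ ℕ._+_ (List.length-map (x ,_) ys) (length-cartesianProduct xs ys))

  map-unique : ∀ (f : A → B) {xs} → (∀ {x y} → x ∈ xs → y ∈ xs → f x ≡ f y → x ≡ y) → Unique xs → Unique (map f xs)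
  map-unique f {[]} _ [] = []
  map-unique f {x ∷ xs} inj (x∉ ∷ u) = All.tabulate f[x]∉ ∷ map-unique f (λ p q → inj (there p) (there q)) u
    where
    f[x]∉ : ∀ {z} → z ∈ map f xs → ¬ f x ≡ z
    f[x]∉ z∈ fx≡z with y , y∈ , refl ← ∈-map⁻ f z∈ = All.lookup x∉ y∈ (inj (here refl) (there y∈) fx≡z)

  record Card {A : Set} (P : Pred A 0ℓ) (n : ℕ) : Set where
    field
      list     : List A
      unique   : Unique list
      length≡  : length list ≡ n
      sound    : ∀ {x} → x ∈ list → P x
      complete : ∀ {x} → P x → x ∈ list


  card-image : Card P n → (g : A → B) → (∀ {x y} → P x → P y → g x ≡ g y → x ≡ y) →
    (∀ {x} → P x → Q (g x)) → (∀ {y} → Q y → ∃ λ x → P x × y ≡ g x) → Card Q n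
  card-image {Q = Q} cP g inj pres onto = record
    { list     = map g (Card.list cP)
    ; unique   = map-unique g (λ p q → inj (Card.sound cP p) (Card.sound cP q)) (Card.unique cP)
    ; length≡  = trans (List.length-map g (Card.list cP)) (Card.length≡ cP)
    ; sound    = λ y∈ → let x , x∈ , y≡ = ∈-map⁻ g y∈ in subst Q (sym y≡) (pres (Card.sound cP x∈))
    ; complete = λ qy → let x , px , y≡ = onto qy in subst (_∈ map g (Card.list cP)) (sym y≡) (∈-map⁺ g (Card.complete cP px))
    }

  card-× : Card P m → Card Q n → Card (λ (x , y) → P x × Q y) (m ℕ.* n)
  card-× cP cQ = record
    { list     = cartesianProduct (Card.list cP) (Card.list cQ)
    ; unique   = Unique.cartesianProduct⁺ (Card.unique cP) (Card.unique cQ)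
    ; length≡  = trans (length-cartesianProduct (Card.list cP) (Card.list cQ)) (cong₂ ℕ._*_ (Card.length≡ cP) (Card.length≡ cQ))
    ; sound    = λ xy∈ → let x∈ , y∈ = ∈-cartesianProduct⁻ (Card.list cP) (Card.list cQ) xy∈ in Card.sound cP x∈ , Card.sound cQ y∈
    ; complete = λ (px , qy) → ∈-cartesianProduct⁺ (Card.complete cP px) (Card.complete cQ qy)
    }

  card-⊆ : {Q : Pred A 0ℓ} → Card P m → Card Q n → (∀ {x} → P x → Q x) → m ≤ n
  card-⊆ cP cQ P⊆Q = subst₂ _≤_ (Card.length≡ cP) (Card.length≡ cQ)
    (unique-⊆⇒length≤ (Card.unique cP) (λ x∈ → Card.complete cQ (P⊆Q (Card.sound cP x∈))))

  card-injection : Card P m → Card Q n → (g : A → B) → (∀ {x} → P x → Q (g x)) →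
    (∀ {x y} → P x → P y → g x ≡ g y → x ≡ y) → m ≤ n
  card-injection {P = P} {B = B} cP cQ g pres inj =
    card-⊆ (card-image {Q = Image} cP g inj (λ px → _ , px , refl) (λ x → x)) cQ λ { (_ , px , refl) → pres px }
    where
    Image : Pred B 0ℓ
    Image y = ∃ λ x → P x × y ≡ g x

  card-filter : (P? : Decidable P) (cP : Card {A} (λ _ → ⊤) n) → Card P (length (filter P? (Card.list cP)))
  card-filter P? cP = record
    { list     = filter P? (Card.list cP)
    ; unique   = Unique.filter⁺ P? (Card.unique cP)
    ; length≡  = refl
    ; sound    = λ x∈ → proj₂ (∈-filter⁻ P? {xs = Card.list cP} x∈)
    ; complete = λ px → ∈-filter⁺ P? (Card.complete cP tt) px
    }

  card-vec : Card P m → ∀ k → Card (λ (v : Vec A k) → ∀ i → P (Vec.lookup v i)) (m ℕ.^ k)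
  card-vec cP zero = record
    { list = [] ∷ [] ; unique = All.[] ∷ [] ; length≡ = refl
    ; sound = λ { (here refl) () } ; complete = λ { {[]} _ → here refl } }
  card-vec cP (suc k) = card-image (card-× cP (card-vec cP k)) (uncurry _∷_)
    (λ _ _ eq → cong₂ _,_ (Vec.∷-injectiveˡ eq) (Vec.∷-injectiveʳ eq))
    (λ { (px , pv) Fin.zero → px ; (px , pv) (Fin.suc i) → pv i })
    (λ { {x ∷ v} pxv → (x , v) , (pxv Fin.zero , λ i → pxv (Fin.suc i)) , refl })

  card-unique : Card P m → Card P n → m ≡ n
  card-unique cP cQ = ℕ.≤-antisym (card-⊆ cP cQ (λ x → x)) (card-⊆ cQ cP (λ x → x))

module FieldProperties (K : FiniteField) where

  open FiniteField K

  commutativeRing : CommutativeRing 0ℓ 0ℓ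
  commutativeRing = record { isCommutativeRing = isCommutativeRing }

  open CommutativeRing commutativeRing public
    using ( +-assoc; +-comm; +-identityˡ; +-identityʳ; -‿inverseˡ; -‿inverseʳ
          ; *-assoc; *-comm; *-identityˡ; *-identityʳ; zeroˡ; zeroʳ
          ; ring; semiring; commutativeSemiring; +-isCommutativeMonoid; *-isCommutativeMonoid)
  open import Algebra.Properties.Ring ring public
    using (+-cancelˡ; +-cancelʳ; -‿distribʳ-*; x∙y⁻¹≈ε⇒x≈y; x≈y⇒x∙y⁻¹≈ε; x+x≈x⇒x≈0; +-inverseˡ-unique)
  open CommutativeRingSolver commutativeRing public
  open import Algebra.Properties.Semiring.Exp semiring using (_^_; ^-assocʳ)
  open import Algebra.Properties.CommutativeSemiring.Exp commutativeSemiring using (^-distrib-*)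
  open ≡-Reasoning

  x-y≡0⇒x≡y : ∀ {x y} → x - y ≡ 0# → x ≡ y
  x-y≡0⇒x≡y = x∙y⁻¹≈ε⇒x≈y _ _

  1≢0 : ¬ 1# ≡ 0#
  1≢0 1≡0 = 0≢1 (sym 1≡0)

  x⁻¹*x≡1 : ∀ {x} → ¬ x ≡ 0# → x ⁻¹ * x ≡ 1#
  x⁻¹*x≡1 {x} x≢0 = trans (*-comm (x ⁻¹) x) (inverseʳ x x≢0)

  x⁻¹*[x*y]≡y : ∀ {x} y → ¬ x ≡ 0# → x ⁻¹ * (x * y) ≡ y
  x⁻¹*[x*y]≡y {x} y x≢0 = begin
    x ⁻¹ * (x * y) ≡⟨ *-assoc (x ⁻¹) x y ⟨
    x ⁻¹ * x * y   ≡⟨ cong (_* y) (x⁻¹*x≡1 x≢0) ⟩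
    1# * y         ≡⟨ *-identityˡ y ⟩
    y              ∎

  x*[x⁻¹*y]≡y : ∀ {x} y → ¬ x ≡ 0# → x * (x ⁻¹ * y) ≡ y
  x*[x⁻¹*y]≡y {x} y x≢0 = trans (sym (*-assoc x (x ⁻¹) y)) (trans (cong (_* y) (inverseʳ x x≢0)) (*-identityˡ y))

  ⁻¹-≢0 : ∀ {x} → ¬ x ≡ 0# → ¬ x ⁻¹ ≡ 0#
  ⁻¹-≢0 {x} x≢0 x⁻¹≡0 = 1≢0 (trans (sym (inverseʳ x x≢0)) (trans (cong (x *_) x⁻¹≡0) (zeroʳ x)))

  *-cancelˡ : ∀ {x y z} → ¬ x ≡ 0# → x * y ≡ x * z → y ≡ z
  *-cancelˡ {x} {y} {z} x≢0 eq =
    trans (sym (x⁻¹*[x*y]≡y y x≢0)) (trans (cong (x ⁻¹ *_) eq) (x⁻¹*[x*y]≡y z x≢0))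

  x*y≡0⇒x≡0⊎y≡0 : ∀ {x y} → x * y ≡ 0# → x ≡ 0# ⊎ y ≡ 0#
  x*y≡0⇒x≡0⊎y≡0 {x} {y} xy≡0 with x ≟ 0#
  ... | yes x≡0 = inj₁ x≡0
  ... | no x≢0  = inj₂ (*-cancelˡ x≢0 (trans xy≡0 (sym (zeroʳ x))))

  *-≢0 : ∀ {x y} → ¬ x ≡ 0# → ¬ y ≡ 0# → ¬ x * y ≡ 0#
  *-≢0 x≢0 y≢0 xy≡0 with x*y≡0⇒x≡0⊎y≡0 xy≡0
  ... | inj₁ x≡0 = x≢0 x≡0
  ... | inj₂ y≡0 = y≢0 y≡0

  ⁻¹-unique : ∀ {x y} → x * y ≡ 1# → y ≡ x ⁻¹
  ⁻¹-unique {x} {y} xy≡1 = *-cancelˡ x≢0 (trans xy≡1 (sym (inverseʳ x x≢0)))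
    where
    x≢0 : ¬ x ≡ 0#
    x≢0 x≡0 = 1≢0 (trans (sym xy≡1) (trans (cong (_* y) x≡0) (zeroˡ y)))

  -‿⁻¹ : ∀ {x} → ¬ x ≡ 0# → (- x) ⁻¹ ≡ - (x ⁻¹)
  -‿⁻¹ {x} x≢0 = sym (⁻¹-unique (trans (solve 2 (λ x y → (:- x) :* (:- y) := x :* y) refl x (x ⁻¹)) (inverseʳ x x≢0)))

  pow≡^ : ∀ x n → pow x n ≡ x ^ n
  pow≡^ x zero    = refl
  pow≡^ x (suc n) = cong (x *_) (pow≡^ x n)

  pow-* : ∀ x m n → pow x (m ℕ.* n) ≡ pow (pow x m) n
  pow-* x m n rewrite pow≡^ (pow x m) n | pow≡^ x m | pow≡^ x (m ℕ.* n) = sym (^-assocʳ x m n)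

  pow-distrib-* : ∀ x y n → pow (x * y) n ≡ pow x n * pow y n
  pow-distrib-* x y n rewrite pow≡^ (x * y) n | pow≡^ x n | pow≡^ y n = ^-distrib-* x y n

  pow-1# : ∀ n → pow 1# n ≡ 1#
  pow-1# zero    = refl
  pow-1# (suc n) = trans (*-identityˡ _) (pow-1# n)

  pow-comm : ∀ x m n → pow (pow x m) n ≡ pow (pow x n) m
  pow-comm x m n = trans (sym (pow-* x m n)) (trans (cong (pow x) (ℕ.*-comm m n)) (pow-* x n m))

  pow-⁻¹ : ∀ {x} n → ¬ x ≡ 0# → pow (x ⁻¹) n ≡ pow x n ⁻¹
  pow-⁻¹ {x} n x≢0 = ⁻¹-unique (begin
    pow x n * pow (x ⁻¹) n ≡⟨ pow-distrib-* x (x ⁻¹) n ⟨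
    pow (x * x ⁻¹) n       ≡⟨ cong (λ y → pow y n) (inverseʳ x x≢0) ⟩
    pow 1# n               ≡⟨ pow-1# n ⟩
    1#                     ∎)

  module _ (m : ℕ) where

    InSub-1 : InSub K m 1#
    InSub-1 = pow-1# m

    InSub-* : ∀ {x y} → InSub K m x → InSub K m y → InSub K m (x * y)
    InSub-* {x} {y} x∈ y∈ = trans (pow-distrib-* x y m) (cong₂ _*_ x∈ y∈)

    InSub-⁻¹ : ∀ {x} → ¬ x ≡ 0# → InSub K m x → InSub K m (x ⁻¹)
    InSub-⁻¹ x≢0 x∈ = trans (pow-⁻¹ m x≢0) (cong _⁻¹ x∈)

    InSub-pow : ∀ {x} n → InSub K m x → InSub K m (pow x n)
    InSub-pow {x} n x∈ = trans (pow-comm x n m) (cong (λ y → pow y n) x∈)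

    InSub-^ : ∀ {x} j → InSub K m x → InSub K (m ℕ.^ j) x
    InSub-^ {x} zero    x∈ = *-identityʳ x
    InSub-^ {x} (suc j) x∈ = trans (pow-* x m (m ℕ.^ j)) (trans (cong (λ y → pow y (m ℕ.^ j)) x∈) (InSub-^ j x∈))

  sumF-cong : ∀ k {g h : Fin k → Carrier} → (∀ i → g i ≡ h i) → sumF k g ≡ sumF k h
  sumF-cong zero    g≗h = refl
  sumF-cong (suc k) g≗h = cong₂ _+_ (g≗h Fin.zero) (sumF-cong k (λ i → g≗h (Fin.suc i)))

  sumF-linear : ∀ k l (g h : Fin k → Carrier) → sumF k (λ i → l * g i + h i) ≡ l * sumF k g + sumF k h
  sumF-linear zero    l g h = sym (trans (+-identityʳ _) (zeroʳ l))
  sumF-linear (suc k) l g h = trans (cong (l * g Fin.zero + h Fin.zero +_) (sumF-linear k l (λ i → g (Fin.suc i)) (λ i → h (Fin.suc i))))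
    (solve 5 (λ l a b S T → (l :* a :+ b) :+ (l :* S :+ T) := l :* (a :+ S) :+ (b :+ T)) refl l _ _ _ _)

  Additive : ℕ → Set
  Additive m = ∀ x y → pow (x + y) m ≡ pow x m + pow y m

  module _ (m : ℕ) (additive : Additive m) where

    pow-0# : pow 0# m ≡ 0#
    pow-0# = x+x≈x⇒x≈0 _ (trans (sym (additive 0# 0#)) (cong (λ x → pow x m) (+-identityʳ 0#)))

    pow-neg : ∀ x → pow (- x) m ≡ - pow x m
    pow-neg x = +-inverseˡ-unique _ _ (begin
      pow (- x) m + pow x m ≡⟨ additive (- x) x ⟨
      pow (- x + x) m       ≡⟨ cong (λ y → pow y m) (-‿inverseˡ x) ⟩
      pow 0# m              ≡⟨ pow-0# ⟩
      0#                    ∎)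

    pow-sub : ∀ x y → pow (x - y) m ≡ pow x m - pow y m
    pow-sub x y = trans (additive x (- y)) (cong (pow x m +_) (pow-neg y))

    InSub-0 : InSub K m 0#
    InSub-0 = pow-0#

    InSub-+ : ∀ {x y} → InSub K m x → InSub K m y → InSub K m (x + y)
    InSub-+ {x} {y} x∈ y∈ = trans (additive x y) (cong₂ _+_ x∈ y∈)

    InSub-sub : ∀ {x y} → InSub K m x → InSub K m y → InSub K m (x - y)
    InSub-sub {x} {y} x∈ y∈ = trans (pow-sub x y) (cong₂ _-_ x∈ y∈)

    InSub-sumF : ∀ k {g : Fin k → Carrier} → (∀ i → InSub K m (g i)) → InSub K m (sumF k g)
    InSub-sumF zero    _   = InSub-0
    InSub-sumF (suc k) g∈ = InSub-+ (g∈ Fin.zero) (InSub-sumF k (λ i → g∈ (Fin.suc i)))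

module Frobenius (K : FiniteField) where

  open FiniteField K
  open FieldProperties K
  open import Algebra.Properties.Semiring.Mult semiring renaming (_×_ to _·_) using (×-assoc-*; ×1-homo-*)
  open import Algebra.Properties.Semiring.Exp semiring using (_^_)
  open import Algebra.Properties.CommutativeSemiring.Binomial commutativeSemiring using (theorem; binomialTerm)
  open import Algebra.Properties.Monoid.Sum (CommutativeRing.+-monoid commutativeRing)
    using (sum; sum-init-last; sum-cong-≗; sum-replicate-zero)
  open import Data.Vec.Functional using (Vector; init; last; tail)
  open ≡-Reasoning

  sum-of-ends : ∀ {n} (v : Vector Carrier (suc (suc n))) → (∀ i → v (Fin.suc (inject₁ i)) ≡ 0#) →
    sum v ≡ v Fin.zero + v (fromℕ (suc n))
  sum-of-ends {n} v middle≡0 = cong (v Fin.zero +_) (begin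
    sum (tail v)                        ≡⟨ sum-init-last (tail v) ⟩
    sum (init (tail v)) + last (tail v) ≡⟨ cong (_+ last (tail v)) (trans (sum-cong-≗ middle≡0) (sum-replicate-zero n)) ⟩
    0# + last (tail v)                  ≡⟨ +-identityˡ _ ⟩
    v (fromℕ (suc n))                   ∎)

  binomialTerm-last : ∀ x y n → binomialTerm x y n (fromℕ n) ≡ pow x n
  binomialTerm-last x y n rewrite Fin.toℕ-fromℕ n | nCn≡1 n | ℕ.n∸n≡0 n =
    trans (+-identityʳ _) (trans (*-identityʳ _) (sym (pow≡^ x n)))

  additive-if-binomials-vanish : ∀ m → (∀ {k} z → 0 < k → k < 2 ℕ.+ m → ((2 ℕ.+ m) C k) · z ≡ 0#) → Additive (2 ℕ.+ m)
  additive-if-binomials-vanish m C·z≡0 x y = begin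
    pow (x + y) n                                 ≡⟨ pow≡^ (x + y) n ⟩
    (x + y) ^ n                                   ≡⟨ theorem n x y ⟩
    sum (binomialTerm x y n)                      ≡⟨ sum-of-ends (binomialTerm x y n) middle≡0 ⟩
    binomialTerm x y n Fin.zero + binomialTerm x y n (fromℕ n) ≡⟨ cong₂ _+_ first (binomialTerm-last x y n) ⟩
    pow y n + pow x n                             ≡⟨ +-comm _ _ ⟩
    pow x n + pow y n                             ∎
    where
    n = 2 ℕ.+ m
    middle≡0 : ∀ i → binomialTerm x y n (Fin.suc (inject₁ i)) ≡ 0#
    middle≡0 i = C·z≡0 _ (s≤s z≤n) (s≤s (subst (_< suc m) (sym (Fin.toℕ-inject₁ i)) (Fin.toℕ<n i)))
    first : binomialTerm x y n Fin.zero ≡ pow y n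
    first = trans (+-identityʳ _) (trans (*-identityˡ _) (sym (pow≡^ y n)))

  module _ {p : ℕ} (p-prime : Prime p) (p·1≡0 : p · 1# ≡ 0#) where

    multiple·x≡0 : ∀ c x → (c ℕ.* p) · x ≡ 0#
    multiple·x≡0 c x = begin
      (c ℕ.* p) · x                ≡⟨ cong ((c ℕ.* p) ·_) (*-identityˡ x) ⟨
      (c ℕ.* p) · (1# * x)         ≡⟨ ×-assoc-* (c ℕ.* p) 1# x ⟨
      ((c ℕ.* p) · 1#) * x         ≡⟨ cong (_* x) (×1-homo-* c p) ⟩
      ((c · 1#) * (p · 1#)) * x    ≡⟨ cong (λ y → ((c · 1#) * y) * x) p·1≡0 ⟩
      ((c · 1#) * 0#) * x          ≡⟨ cong (_* x) (zeroʳ (c · 1#)) ⟩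
      0# * x                       ≡⟨ zeroˡ x ⟩
      0#                           ∎

    frobenius : Additive p
    frobenius = subst Additive p≡2+m (additive-if-binomials-vanish m C·z≡0)
      where
      m = p ℕ.∸ 2
      p≡2+m : 2 ℕ.+ m ≡ p
      p≡2+m = ℕ.m+[n∸m]≡n (ℕ.nonTrivial⇒n>1 p {{prime⇒nonTrivial p-prime}})
      C·z≡0 : ∀ {k} z → 0 < k → k < 2 ℕ.+ m → ((2 ℕ.+ m) C k) · z ≡ 0#
      C·z≡0 z 0<k k<2+m rewrite p≡2+m with divides c pCk≡c*p ← prime∣binomial p-prime 0<k k<2+m =
        trans (cong (_· z) pCk≡c*p) (multiple·x≡0 c z)

    frobenius-^ : ∀ e → Additive (p ℕ.^ e)
    frobenius-^ zero    x y = trans (*-identityʳ _) (sym (cong₂ _+_ (*-identityʳ x) (*-identityʳ y)))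
    frobenius-^ (suc e) x y = begin
      pow (x + y) (p ℕ.* p ℕ.^ e)                         ≡⟨ pow-* (x + y) p (p ℕ.^ e) ⟩
      pow (pow (x + y) p) (p ℕ.^ e)                       ≡⟨ cong (λ z → pow z (p ℕ.^ e)) (frobenius x y) ⟩
      pow (pow x p + pow y p) (p ℕ.^ e)                   ≡⟨ frobenius-^ e _ _ ⟩
      pow (pow x p) (p ℕ.^ e) + pow (pow y p) (p ℕ.^ e)   ≡⟨ cong₂ _+_ (pow-* x p _) (pow-* y p _) ⟨
      pow x (p ℕ.* p ℕ.^ e) + pow y (p ℕ.* p ℕ.^ e)       ∎

module FiniteFieldProperties (K : FiniteField) where

  open FiniteField K
  open FieldProperties K
  open import Algebra.Properties.Semiring.Mult semiring renaming (_×_ to _·_) using (×1-homo-*)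
  open import Algebra.Properties.Ring ring using (+-identityˡ-unique)
  open ≡-Reasoning

  everything : Card (λ (_ : Carrier) → ⊤) size
  everything = record
    { list = elements ; unique = unique ; length≡ = refl ; sound = λ _ → tt ; complete = λ _ → complete _ }

  sum-map-+ : ∀ x xs → foldr _+_ 0# (map (x +_) xs) ≡ length xs · x + foldr _+_ 0# xs
  sum-map-+ x []       = sym (+-identityʳ 0#)
  sum-map-+ x (y ∷ xs) = trans (cong ((x + y) +_) (sum-map-+ x xs))
    (solve 4 (λ x y a s → (x :+ y) :+ (a :+ s) := (x :+ a) :+ (y :+ s)) refl x y _ _)

  size·x≡0 : ∀ x → size · x ≡ 0#
  size·x≡0 x = +-identityˡ-unique (size · x) (∑ elements) (begin
    size · x + ∑ elements    ≡⟨ sum-map-+ x elements ⟨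
    ∑ (map (x +_) elements)  ≡⟨ foldr-unique-cong +-isCommutativeMonoid shifted-unique unique same-members ⟩
    ∑ elements               ∎)
    where
    ∑ = foldr _+_ 0#
    shifted-unique : Unique (map (x +_) elements)
    shifted-unique = Unique.map⁺ (+-cancelˡ x _ _) unique
    same-members : ∀ {z} → z ∈ map (x +_) elements ⇔ z ∈ elements
    same-members {z} = mk⇔ (λ _ → complete z)
      (λ _ → subst (_∈ map (x +_) elements) (solve 2 (λ x z → x :+ (:- x :+ z) := z) refl x z) (∈-map⁺ (x +_) (complete (- x + z))))

  prime-power-characteristic : ∀ p e → size ≡ p ℕ.^ e → p · 1# ≡ 0#
  prime-power-characteristic p e size≡p^e = go e (subst (λ n → n · 1# ≡ 0#) size≡p^e (size·x≡0 1#))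
    where
    go : ∀ e → (p ℕ.^ e) · 1# ≡ 0# → p · 1# ≡ 0#
    go zero    1+0≡0 = contradiction (trans (sym (+-identityʳ 1#)) 1+0≡0) 1≢0
    go (suc e) p^[1+e]·1≡0 with x*y≡0⇒x≡0⊎y≡0 (trans (sym (×1-homo-* p (p ℕ.^ e))) p^[1+e]·1≡0)
    ... | inj₁ p·1≡0   = p·1≡0
    ... | inj₂ p^e·1≡0 = go e p^e·1≡0

  nonzero : List Carrier
  nonzero = filter (λ z → ¬? (z ≟ 0#)) elements

  nonzero-unique : Unique nonzero
  nonzero-unique = Unique.filter⁺ (λ z → ¬? (z ≟ 0#)) unique

  ∈-nonzero⁺ : ∀ {z} → ¬ z ≡ 0# → z ∈ nonzero
  ∈-nonzero⁺ {z} = ∈-filter⁺ (λ z → ¬? (z ≟ 0#)) (complete z)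

  ∈-nonzero⁻ : ∀ {z} → z ∈ nonzero → ¬ z ≡ 0#
  ∈-nonzero⁻ z∈ = proj₂ (∈-filter⁻ (λ z → ¬? (z ≟ 0#)) {xs = elements} z∈)

  size≡1+nonzero : size ≡ suc (length nonzero)
  size≡1+nonzero = ↭-length (unique∧same-members⇒↭ unique (0∉nonzero ∷ nonzero-unique) (mk⇔ to (λ _ → complete _)))
    where
    0∉nonzero : All.All (λ z → ¬ 0# ≡ z) nonzero
    0∉nonzero = All.tabulate (λ z∈ 0≡z → ∈-nonzero⁻ z∈ (sym 0≡z))
    to : ∀ {z} → z ∈ elements → z ∈ 0# ∷ nonzero
    to {z} _ with z ≟ 0#
    ... | yes z≡0 = here z≡0
    ... | no z≢0  = there (∈-nonzero⁺ z≢0)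

  product-map-* : ∀ x xs → foldr _*_ 1# (map (x *_) xs) ≡ pow x (length xs) * foldr _*_ 1# xs
  product-map-* x []       = sym (*-identityʳ 1#)
  product-map-* x (y ∷ xs) = trans (cong ((x * y) *_) (product-map-* x xs))
    (solve 4 (λ x y a s → (x :* y) :* (a :* s) := (x :* a) :* (y :* s)) refl x y _ _)

  product-≢0 : ∀ xs → (∀ {z} → z ∈ xs → ¬ z ≡ 0#) → ¬ foldr _*_ 1# xs ≡ 0#
  product-≢0 []       _      = 1≢0
  product-≢0 (y ∷ xs) all≢0 = *-≢0 (all≢0 (here refl)) (product-≢0 xs (λ z∈ → all≢0 (there z∈)))

  pow-nonzero≡1 : ∀ {x} → ¬ x ≡ 0# → pow x (length nonzero) ≡ 1#
  pow-nonzero≡1 {x} x≢0 = sym (*-cancelˡ (product-≢0 nonzero ∈-nonzero⁻) (begin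
    Π nonzero * 1#                       ≡⟨ *-identityʳ _ ⟩
    Π nonzero                            ≡⟨ foldr-unique-cong *-isCommutativeMonoid scaled-unique nonzero-unique same-members ⟨
    Π (map (x *_) nonzero)               ≡⟨ product-map-* x nonzero ⟩
    pow x (length nonzero) * Π nonzero   ≡⟨ *-comm _ _ ⟩
    Π nonzero * pow x (length nonzero)   ∎))
    where
    Π = foldr _*_ 1#
    scaled-unique : Unique (map (x *_) nonzero)
    scaled-unique = Unique.map⁺ (*-cancelˡ x≢0) nonzero-unique
    same-members : ∀ {z} → z ∈ map (x *_) nonzero ⇔ z ∈ nonzero
    same-members {z} = mk⇔ to from
      where
      to : z ∈ map (x *_) nonzero → z ∈ nonzero
      to z∈ with w , w∈ , refl ← ∈-map⁻ (x *_) z∈ = ∈-nonzero⁺ (*-≢0 x≢0 (∈-nonzero⁻ w∈))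
      from : z ∈ nonzero → z ∈ map (x *_) nonzero
      from z∈ = subst (_∈ map (x *_) nonzero) (x*[x⁻¹*y]≡y z x≢0)
        (∈-map⁺ (x *_) (∈-nonzero⁺ (*-≢0 (⁻¹-≢0 x≢0) (∈-nonzero⁻ z∈))))

  fermat : ∀ x → pow x size ≡ x
  fermat x rewrite size≡1+nonzero with x ≟ 0#
  ... | yes refl = zeroˡ _
  ... | no x≢0   = trans (cong (x *_) (pow-nonzero≡1 x≢0)) (*-identityʳ x)

  size≤image*kernel : ∀ {P : Carrier → Set} {a b} (φ : Carrier → Carrier) → (∀ x y → φ (x - y) ≡ φ x - φ y) →
    Card P a → (∀ x → P (φ x)) → Card (λ x → φ x ≡ 0#) b → size ≤ a ℕ.* b
  size≤image*kernel φ φ-sub image φ∈image kernel =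
    card-injection everything (card-× image kernel) (λ x → φ x , x - preimage (φ x))
      (λ {x} _ → φ∈image x , trans (φ-sub x _) (x≈y⇒x∙y⁻¹≈ε (sym (φ∘preimage x)))) injective
    where
    preimage : Carrier → Carrier
    preimage y with any? (λ z → φ z ≟ y) elements
    ... | yes ∃z = proj₁ (satisfied ∃z)
    ... | no _   = y   -- junk: y is not in the image of φ
    φ∘preimage : ∀ x → φ (preimage (φ x)) ≡ φ x
    φ∘preimage x with any? (λ z → φ z ≟ φ x) elements
    ... | yes ∃z  = proj₂ (satisfied ∃z)
    ... | no ∄z   = contradiction (lose (complete x) refl) ∄z
    injective : ∀ {x y} → ⊤ → ⊤ → (φ x , x - preimage (φ x)) ≡ (φ y , y - preimage (φ y)) → x ≡ y
    injective {x} {y} _ _ eq = begin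
      x                                  ≡⟨ solve 2 (λ x s → x := (x :- s) :+ s) refl x (preimage (φ x)) ⟩
      (x - preimage (φ x)) + preimage (φ x) ≡⟨ cong₂ _+_ (cong proj₂ eq) (cong preimage (cong proj₁ eq)) ⟩
      (y - preimage (φ y)) + preimage (φ y) ≡⟨ solve 2 (λ y s → (y :- s) :+ s := y) refl y (preimage (φ y)) ⟩
      y                                  ∎

module PolynomialFunctions (K : FiniteField) where

  open FiniteField K
  open FieldProperties K
  open ≡-Reasoning

  -- Polynomial functions in Horner form: F has degree ≤ d + 1 when F x = x * G x + c with G of
  -- degree ≤ d; a monic F of degree d + 1 has a monic G of degree d.
  Polynomial : ℕ → (Carrier → Carrier) → Set
  Polynomial zero    F = Σ Carrier λ c → ∀ x → F x ≡ c
  Polynomial (suc d) F = Σ (Carrier → Carrier) λ G → Σ Carrier λ c → Polynomial d G × (∀ x → F x ≡ x * G x + c)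

  Monic : ℕ → (Carrier → Carrier) → Set
  Monic zero    F = ∀ x → F x ≡ 1#
  Monic (suc d) F = Σ (Carrier → Carrier) λ G → Σ Carrier λ c → Monic d G × (∀ x → F x ≡ x * G x + c)

  monic-cong : ∀ d {F F′} → Monic d F → (∀ x → F x ≡ F′ x) → Monic d F′
  monic-cong zero    F≡1                  F≗F′ x = trans (sym (F≗F′ x)) (F≡1 x)
  monic-cong (suc d) (G , c , monic , F≡) F≗F′ = G , c , monic , λ x → trans (sym (F≗F′ x)) (F≡ x)

  polynomial-const : ∀ d c → Polynomial d (λ _ → c)
  polynomial-const zero    c = c , λ _ → refl
  polynomial-const (suc d) c = (λ _ → 0#) , c , polynomial-const d 0# ,
    λ x → sym (trans (cong (_+ c) (zeroʳ x)) (+-identityˡ c))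

  polynomial-suc : ∀ d {F} → Polynomial d F → Polynomial (suc d) F
  polynomial-suc zero    (c , F≡c)             = (λ _ → 0#) , c , (0# , λ _ → refl) ,
    λ x → trans (F≡c x) (sym (trans (cong (_+ c) (zeroʳ x)) (+-identityˡ c)))
  polynomial-suc (suc d) (G , c , poly , F≡) = G , c , polynomial-suc d poly , F≡

  polynomial-≤ : ∀ {d e F} → d ≤ e → Polynomial d F → Polynomial e F
  polynomial-≤ {d} {e} {F} d≤e poly with o , refl ← ℕ.m≤n⇒∃[o]m+o≡n d≤e = raise o
    where
    raise : ∀ o → Polynomial (d ℕ.+ o) F
    raise zero    = subst (λ k → Polynomial k F) (sym (ℕ.+-identityʳ d)) poly
    raise (suc o) = subst (λ k → Polynomial k F) (sym (ℕ.+-suc d o)) (polynomial-suc _ (raise o))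

  polynomial-+ : ∀ d {F G} → Polynomial d F → Polynomial d G → Polynomial d (λ x → F x + G x)
  polynomial-+ zero    (c , F≡c) (c′ , G≡c′) = c + c′ , λ x → cong₂ _+_ (F≡c x) (G≡c′ x)
  polynomial-+ (suc d) (H , c , pH , F≡) (H′ , c′ , pH′ , G≡) = (λ x → H x + H′ x) , c + c′ , polynomial-+ d pH pH′ ,
    λ x → trans (cong₂ _+_ (F≡ x) (G≡ x))
      (solve 5 (λ x a b c d → (x :* a :+ c) :+ (x :* b :+ d) := x :* (a :+ b) :+ (c :+ d)) refl x (H x) (H′ x) c c′)

  monic⇒polynomial : ∀ d {F} → Monic d F → Polynomial d F
  monic⇒polynomial zero    F≡1                = 1# , F≡1
  monic⇒polynomial (suc d) (G , c , monic , F≡) = G , c , monic⇒polynomial d monic , F≡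

  monic-+ : ∀ d {F G} → Monic (suc d) F → Polynomial d G → Monic (suc d) (λ x → F x + G x)
  monic-+ zero    (H , c , H≡1 , F≡) (c′ , G≡c′) = H , c + c′ , H≡1 ,
    λ x → trans (cong₂ _+_ (F≡ x) (G≡c′ x)) (+-assoc _ _ _)
  monic-+ (suc d) (H , c , mH , F≡) (H′ , c′ , pH′ , G≡) = (λ x → H x + H′ x) , c + c′ , monic-+ d mH pH′ ,
    λ x → trans (cong₂ _+_ (F≡ x) (G≡ x))
      (solve 5 (λ x a b c d → (x :* a :+ c) :+ (x :* b :+ d) := x :* (a :+ b) :+ (c :+ d)) refl x (H x) (H′ x) c c′)

  monic-pow : ∀ n → Monic n (λ x → pow x n)
  monic-pow zero    = λ _ → refl
  monic-pow (suc n) = (λ x → pow x n) , 0# , monic-pow n , λ x → sym (+-identityʳ _)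

  factor-theorem : ∀ d {F} → Monic (suc d) F → ∀ r →
    Σ (Carrier → Carrier) λ H → Monic d H × (∀ x → F x ≡ (x - r) * H x + F r)
  factor-theorem zero {F} (G , c , G≡1 , F≡) r = (λ _ → 1#) , (λ _ → refl) , λ x → begin
    F x                           ≡⟨ F≡ x ⟩
    x * G x + c                   ≡⟨ cong (λ z → x * z + c) (G≡1 x) ⟩
    x * 1# + c                    ≡⟨ solve 4 (λ x r c o → x :* o :+ c := (x :- r) :* o :+ (r :* o :+ c)) refl x r c 1# ⟩
    (x - r) * 1# + (r * 1# + c)   ≡⟨ cong (λ z → (x - r) * 1# + (r * z + c)) (sym (G≡1 r)) ⟩
    (x - r) * 1# + (r * G r + c)  ≡⟨ cong ((x - r) * 1# +_) (sym (F≡ r)) ⟩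
    (x - r) * 1# + F r            ∎
  factor-theorem (suc d) {F} (G , c , mG , F≡) r with H , mH , G≡ ← factor-theorem d mG r =
    (λ x → x * H x + G r) , (H , G r , mH , λ _ → refl) , λ x → begin
      F x                                          ≡⟨ F≡ x ⟩
      x * G x + c                                  ≡⟨ cong (λ z → x * z + c) (G≡ x) ⟩
      x * ((x - r) * H x + G r) + c                ≡⟨ solve 5 (λ x r h g c → x :* ((x :- r) :* h :+ g) :+ c := (x :- r) :* (x :* h :+ g) :+ (r :* g :+ c)) refl x r (H x) (G r) c ⟩
      (x - r) * (x * H x + G r) + (r * G r + c)    ≡⟨ cong ((x - r) * (x * H x + G r) +_) (sym (F≡ r)) ⟩
      (x - r) * (x * H x + G r) + F r              ∎

  monic-roots≤degree : ∀ d {F} → Monic d F → ∀ (rs : List Carrier) → Unique rs → (∀ {z} → z ∈ rs → F z ≡ 0#) → length rs ≤ d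
  monic-roots≤degree d       _     []       _ _ = z≤n
  monic-roots≤degree zero    F≡1   (r ∷ rs) _ roots = contradiction (trans (sym (F≡1 r)) (roots (here refl))) 1≢0
  monic-roots≤degree (suc d) {F} monic (r ∷ rs) (r∉ ∷ u) roots with H , mH , F≡ ← factor-theorem d monic r =
    s≤s (monic-roots≤degree d mH rs u H-roots)
    where
    H-roots : ∀ {z} → z ∈ rs → H z ≡ 0#
    H-roots {z} z∈ with x*y≡0⇒x≡0⊎y≡0 (begin
        (z - r) * H z        ≡⟨ +-identityʳ _ ⟨
        (z - r) * H z + 0#   ≡⟨ cong ((z - r) * H z +_) (roots (here refl)) ⟨
        (z - r) * H z + F r  ≡⟨ F≡ z ⟨
        F z                  ≡⟨ roots (there z∈) ⟩
        0#                   ∎)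
    ... | inj₁ z-r≡0 = contradiction (sym (x-y≡0⇒x≡y z-r≡0)) (All.lookup r∉ z∈)
    ... | inj₂ Hz≡0  = Hz≡0

  card-roots≤degree : ∀ d {F P n} → Monic d F → Card P n → (∀ {z} → P z → F z ≡ 0#) → n ≤ d
  card-roots≤degree d monic roots-card roots = subst (_≤ d) (Card.length≡ roots-card)
    (monic-roots≤degree d monic (Card.list roots-card) (Card.unique roots-card) (λ z∈ → roots (Card.sound roots-card z∈)))

module Dimension (K : FiniteField) (q : ℕ) where

  open FiniteField K
  open FieldProperties K
  open ≡-Reasoning

  module _ {V : Set} {_⊕_ : V → V → V} {o : V} {_·_ : Carrier → V → V} {P : V → Set} {k : ℕ}
    (basis : HasDim K q _⊕_ o _·_ P k) (_⊖_ : V → V → V)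
    (⊖-self : ∀ x → x ⊖ x ≡ o)
    (⊖-⊕ : ∀ a b c d → (a ⊕ b) ⊖ (c ⊕ d) ≡ (a ⊖ c) ⊕ (b ⊖ d))
    (⊖-· : ∀ l m v → (l · v) ⊖ (m · v) ≡ (l - m) · v)
    where

    private
      combination : ∀ {k} → (Fin k → Carrier) → (Fin k → V) → V
      combination {k} = lincomb K q _⊕_ o _·_ k

    combination-sub : ∀ {k} (ls ms : Fin k → Carrier) b →
      combination (λ i → ls i - ms i) b ≡ combination ls b ⊖ combination ms b
    combination-sub {zero}  ls ms b = sym (⊖-self o)
    combination-sub {suc k} ls ms b = trans
      (cong₂ _⊕_ (sym (⊖-· _ _ _)) (combination-sub (λ i → ls (Fin.suc i)) (λ i → ms (Fin.suc i)) (λ i → b (Fin.suc i))))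
      (sym (⊖-⊕ _ _ _ _))

    combination-cong : ∀ {k} {ls ms : Fin k → Carrier} b → (∀ i → ls i ≡ ms i) → combination ls b ≡ combination ms b
    combination-cong {zero}  b ls≗ms = refl
    combination-cong {suc k} b ls≗ms =
      cong₂ (λ l v → (l · b Fin.zero) ⊕ v) (ls≗ms Fin.zero) (combination-cong (λ i → b (Fin.suc i)) (λ i → ls≗ms (Fin.suc i)))

    module _ (InSub-q-sub : ∀ {a b} → InSub K q a → InSub K q b → InSub K q (a - b))
             (P-o : P o) (P-lin : ∀ {l x y} → InSub K q l → P x → P y → P ((l · x) ⊕ y)) where

      combination-closed : ∀ {k} ls b → (∀ i → InSub K q (ls i)) → (∀ i → P (b i)) → P (combination {k} ls b)
      combination-closed {zero}  ls b _    _    = P-o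
      combination-closed {suc k} ls b ls∈ b∈P =
        P-lin (ls∈ Fin.zero) (b∈P Fin.zero) (combination-closed _ _ (λ i → ls∈ (Fin.suc i)) (λ i → b∈P (Fin.suc i)))

      dim⇒card : ∀ {n} → Card (InSub K q) n → Card P (n ℕ.^ k)
      dim⇒card card-F_q = card-image (card-vec card-F_q k) (λ v → combination (Vec.lookup v) b) injective
          (λ v∈ → combination-closed _ b v∈ b∈P) onto
        where
        b = proj₁ basis
        b∈P = proj₁ (proj₂ basis)
        independent = proj₁ (proj₂ (proj₂ basis))
        spanning = proj₂ (proj₂ (proj₂ basis))
        injective : ∀ {v w : Vec Carrier k} → (∀ i → InSub K q (Vec.lookup v i)) → (∀ i → InSub K q (Vec.lookup w i)) →
          combination (Vec.lookup v) b ≡ combination (Vec.lookup w) b → v ≡ w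
        injective {v} {w} v∈ w∈ eq = begin
          v                      ≡⟨ Vec.tabulate∘lookup v ⟨
          Vec.tabulate (Vec.lookup v)    ≡⟨ Vec.tabulate-cong (λ i → x-y≡0⇒x≡y (independent _ (λ i → InSub-q-sub (v∈ i) (w∈ i)) difference≡o i)) ⟩
          Vec.tabulate (Vec.lookup w)    ≡⟨ Vec.tabulate∘lookup w ⟩
          w                      ∎
          where
          difference≡o : combination (λ i → Vec.lookup v i - Vec.lookup w i) b ≡ o
          difference≡o = trans (combination-sub _ _ b) (trans (cong (_⊖ combination (Vec.lookup w) b) eq) (⊖-self _))
        onto : ∀ {x} → P x → Σ (Vec Carrier k) λ v → (∀ i → InSub K q (Vec.lookup v i)) × x ≡ combination (Vec.lookup v) b
        onto x∈P with ls , ls∈ , x≡ ← spanning _ x∈P =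
          Vec.tabulate ls , (λ i → subst (InSub K q) (sym (Vec.lookup∘tabulate ls i)) (ls∈ i)) ,
          trans x≡ (combination-cong b (λ i → sym (Vec.lookup∘tabulate ls i)))

  dimK⇒card : ∀ {P k} → DimK K q P k → (∀ {a b} → InSub K q a → InSub K q b → InSub K q (a - b)) →
    P 0# → (∀ {l x y} → InSub K q l → P x → P y → P (l * x + y)) → ∀ {n} → Card (InSub K q) n → Card P (n ℕ.^ k)
  dimK⇒card basis = dim⇒card basis _-_ -‿inverseʳ
    (λ a b c d → solve 4 (λ a b c d → (a :+ b) :- (c :+ d) := (a :- c) :+ (b :- d)) refl a b c d)
    (λ l m v → solve 3 (λ l m v → l :* v :- m :* v := (l :- m) :* v) refl l m v)

  dimK²⇒card : ∀ {P k} → DimK² K q P k → (∀ {a b} → InSub K q a → InSub K q b → InSub K q (a - b)) →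
    P (0# , 0#) → (∀ {l x x′ y y′} → InSub K q l → P (x , y) → P (x′ , y′) → P (l * x + x′ , l * y + y′)) →
    ∀ {n} → Card (InSub K q) n → Card P (n ℕ.^ k)
  dimK²⇒card {P} basis InSub-q-sub P-o P-lin = dim⇒card basis _⊖_
    (λ (x , y) → cong₂ _,_ (-‿inverseʳ x) (-‿inverseʳ y))
    (λ (a , a′) (b , b′) (c , c′) (d , d′) → cong₂ _,_
      (solve 4 (λ a b c d → (a :+ b) :- (c :+ d) := (a :- c) :+ (b :- d)) refl a b c d)
      (solve 4 (λ a b c d → (a :+ b) :- (c :+ d) := (a :- c) :+ (b :- d)) refl a′ b′ c′ d′))
    (λ l m (x , y) → cong₂ _,_
      (solve 3 (λ l m v → l :* v :- m :* v := (l :- m) :* v) refl l m x)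
      (solve 3 (λ l m v → l :* v :- m :* v := (l :- m) :* v) refl l m y))
    InSub-q-sub P-o (λ { {x = _ , _} {y = _ , _} → P-lin })
    where
    _⊖_ : Carrier × Carrier → Carrier × Carrier → Carrier × Carrier
    (x , y) ⊖ (x′ , y′) = (x - x′ , y - y′)

module FieldOfOrder (K : FiniteField) {q : ℕ} (q-primePower : IsPrimePower q)
  {n : ℕ} (size≡q^[1+n] : FiniteField.size K ≡ q ℕ.^ suc n) where

  private
    p = proj₁ q-primePower
    k = proj₁ (proj₂ q-primePower)
    p-prime = proj₁ (proj₂ (proj₂ q-primePower))
    q≡p^[1+k] = proj₂ (proj₂ (proj₂ q-primePower))

  open FiniteField K
  open FieldProperties K
  open FiniteFieldProperties K
  open PolynomialFunctions K
  open import Algebra.Properties.Semiring.Mult semiring renaming (_×_ to _·_) using ()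

  q^j≡p^[[1+k]*j] : ∀ j → q ℕ.^ j ≡ p ℕ.^ (suc k ℕ.* j)
  q^j≡p^[[1+k]*j] j = trans (cong (ℕ._^ j) q≡p^[1+k]) (ℕ.^-*-assoc p (suc k) j)

  p·1≡0 : p · 1# ≡ 0#
  p·1≡0 = prime-power-characteristic p (suc k ℕ.* suc n) (trans size≡q^[1+n] (q^j≡p^[[1+k]*j] (suc n)))

  additive-q^ : ∀ j → Additive (q ℕ.^ j)
  additive-q^ j = subst Additive (sym (q^j≡p^[[1+k]*j] j)) (Frobenius.frobenius-^ K p-prime p·1≡0 (suc k ℕ.* j))

  additive-q : Additive q
  additive-q = subst Additive (ℕ.*-identityʳ q) (additive-q^ 1)

  1<q : 1 < q
  1<q = subst (1 <_) (sym q≡p^[1+k]) (ℕ.<-≤-trans 1<p (ℕ.m≤m*n p (p ℕ.^ k)))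
    where
    1<p = ℕ.nonTrivial⇒n>1 p {{prime⇒nonTrivial p-prime}}
    instance
      p≢0 = ℕ.>-nonZero (ℕ.<-trans (s≤s z≤n) 1<p)
      p^k≢0 = ℕ.m^n≢0 p k

  fermat-q^[1+n] : ∀ x → pow x (q ℕ.^ suc n) ≡ x
  fermat-q^[1+n] x = subst (λ m → pow x m ≡ x) size≡q^[1+n] (fermat x)

  monic-X^m-X : ∀ m → 1 < m → Monic m (λ x → pow x m - x)
  monic-X^m-X (suc zero)    (s≤s ())
  monic-X^m-X (suc (suc m)) _ = monic-+ (suc m) (monic-pow (2 ℕ.+ m)) (polynomial-≤ (s≤s z≤n) -X)
    where
    -X : Polynomial 1 (λ x → - x)
    -X = (λ _ → - 1#) , 0# , (- 1# , λ _ → refl) ,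
      λ x → sym (trans (+-identityʳ _) (trans (sym (-‿distribʳ-* x 1#)) (cong -_ (*-identityʳ x))))

  InSub-q-sub : ∀ {x y} → InSub K q x → InSub K q y → InSub K q (x - y)
  InSub-q-sub = InSub-sub q additive-q

  card-InSub-q≤q : ∀ {m} → Card (InSub K q) m → m ≤ q
  card-InSub-q≤q F_q = card-roots≤degree q (monic-X^m-X q 1<q) F_q (x≈y⇒x∙y⁻¹≈ε)

  trace : ℕ → Carrier → Carrier
  trace zero    x = 0#
  trace (suc j) x = trace j x + pow x (q ℕ.^ j)

  trace-sub : ∀ j x y → trace j (x - y) ≡ trace j x - trace j y
  trace-sub zero    x y = sym (-‿inverseʳ 0#)
  trace-sub (suc j) x y = trans (cong₂ _+_ (trace-sub j x y) (pow-sub (q ℕ.^ j) (additive-q^ j) x y))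
    (solve 4 (λ a b c d → (a :- b) :+ (c :- d) := (a :+ c) :- (b :+ d)) refl _ _ _ _)

  trace-pow-q : ∀ j x → pow (trace j x) q ≡ trace j (pow x q)
  trace-pow-q zero    x = pow-0# q additive-q
  trace-pow-q (suc j) x = trans (additive-q _ _) (cong₂ _+_ (trace-pow-q j x) (pow-comm x (q ℕ.^ j) q))

  trace-shift : ∀ j x → trace j (pow x q) + x ≡ trace j x + pow x (q ℕ.^ j)
  trace-shift zero    x = trans (+-identityˡ x) (sym (trans (+-identityˡ _) (*-identityʳ x)))
  trace-shift (suc j) x = begin
    trace j (pow x q) + pow (pow x q) (q ℕ.^ j) + x     ≡⟨ solve 3 (λ a b c → (a :+ b) :+ c := (a :+ c) :+ b) refl _ _ x ⟩
    trace j (pow x q) + x + pow (pow x q) (q ℕ.^ j)     ≡⟨ cong₂ _+_ (trace-shift j x) (sym (pow-* x q (q ℕ.^ j))) ⟩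
    trace j x + pow x (q ℕ.^ j) + pow x (q ℕ.^ suc j)  ∎
    where open ≡-Reasoning

  trace-InSub : ∀ x → InSub K q (trace (suc n) x)
  trace-InSub x = trans (trace-pow-q (suc n) x) (+-cancelʳ _ _ _ (trans (trace-shift (suc n) x) (cong (trace (suc n) x +_) (fermat-q^[1+n] x))))

  private instance
    q^n≢0 : ℕ.NonZero (q ℕ.^ n)
    q^n≢0 = ℕ.m^n≢0 q n {{ℕ.>-nonZero (ℕ.<-trans (s≤s z≤n) 1<q)}}

  trace-degree : ∀ {j} → j ≤ n → Polynomial (ℕ.pred (q ℕ.^ n)) (trace j)
  trace-degree {zero}  _     = polynomial-const _ 0#
  trace-degree {suc j} 1+j≤n = polynomial-+ _ (trace-degree (ℕ.<⇒≤ 1+j≤n))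
    (polynomial-≤ (ℕ.<⇒≤pred (ℕ.^-monoʳ-< q 1<q 1+j≤n)) (monic⇒polynomial _ (monic-pow (q ℕ.^ j))))

  trace-monic : Monic (q ℕ.^ n) (trace (suc n))
  trace-monic = subst (λ d → Monic d (trace (suc n))) (ℕ.suc-pred (q ℕ.^ n))
    (monic-cong _ (monic-+ _ X^q^n (trace-degree ℕ.≤-refl)) (λ x → +-comm _ _))
    where
    X^q^n : Monic (suc (ℕ.pred (q ℕ.^ n))) (λ x → pow x (q ℕ.^ n))
    X^q^n = subst (λ d → Monic d (λ x → pow x (q ℕ.^ n))) (sym (ℕ.suc-pred (q ℕ.^ n))) (monic-pow (q ℕ.^ n))

  card-InSub-q : Card (InSub K q) q
  card-InSub-q = subst (Card (InSub K q)) (ℕ.≤-antisym (card-InSub-q≤q F_q) q≤|F_q|) F_q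
    where
    F_q = card-filter (λ x → pow x q ≟ x) everything
    kernel = card-filter (λ x → trace (suc n) x ≟ 0#) everything
    |F_q| = length (filter (λ x → pow x q ≟ x) elements)
    q≤|F_q| : q ≤ |F_q|
    q≤|F_q| = ℕ.*-cancelʳ-≤ q |F_q| (q ℕ.^ n) (ℕ.≤-trans (ℕ.≤-reflexive (sym size≡q^[1+n]))
      (ℕ.≤-trans (size≤image*kernel (trace (suc n)) (trace-sub (suc n)) F_q trace-InSub kernel)
                 (ℕ.*-monoʳ-≤ |F_q| (card-roots≤degree (q ℕ.^ n) trace-monic kernel (λ z → z)))))

module QuadraticExtension (K : FiniteField) {q : ℕ} (q-primePower : IsPrimePower q)
  {t : ℕ} (1≤t : 1 ≤ t) (size≡q^[2t] : FiniteField.size K ≡ q ℕ.^ (2 ℕ.* t)) where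

  open FiniteField K
  open FieldProperties K
  open FiniteFieldProperties K

  2t≡1+[2t-1] : 2 ℕ.* t ≡ suc (2 ℕ.* t ℕ.∸ 1)
  2t≡1+[2t-1] = sym (ℕ.suc-pred (2 ℕ.* t) {{ℕ.>-nonZero (ℕ.≤-trans 1≤t (ℕ.m≤m+n t _))}})

  open FieldOfOrder K q-primePower {n = 2 ℕ.* t ℕ.∸ 1} (trans size≡q^[2t] (cong (q ℕ.^_) 2t≡1+[2t-1])) public

  F : Carrier → Set
  F = InSub K (q ℕ.^ t)

  F-0 : F 0#
  F-0 = InSub-0 (q ℕ.^ t) (additive-q^ t)

  F-+ : ∀ {x y} → F x → F y → F (x + y)
  F-+ = InSub-+ (q ℕ.^ t) (additive-q^ t)

  F-* : ∀ {x y} → F x → F y → F (x * y)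
  F-* = InSub-* (q ℕ.^ t)

  F-sumF : ∀ {g : Fin t → Carrier} → (∀ i → F (g i)) → F (sumF t g)
  F-sumF = InSub-sumF (q ℕ.^ t) (additive-q^ t) t

  F_q⊆F : ∀ {x} → InSub K q x → F x
  F_q⊆F = InSub-^ q t

  q^t*q^t≡size : q ℕ.^ t ℕ.* q ℕ.^ t ≡ size
  q^t*q^t≡size = trans (sym (ℕ.^-distribˡ-+-* q t t)) (trans (cong (λ m → q ℕ.^ (t ℕ.+ m)) (sym (ℕ.+-identityʳ t))) (sym size≡q^[2t]))

  conjugate-involutive : ∀ x → pow (pow x (q ℕ.^ t)) (q ℕ.^ t) ≡ x
  conjugate-involutive x = trans (sym (pow-* x (q ℕ.^ t) (q ℕ.^ t))) (trans (cong (pow x) q^t*q^t≡size) (fermat x))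

  module Coordinates (γ : Carrier) (γ∉F : ¬ F γ) where
    open ≡-Reasoning

    Q = q ℕ.^ t
    γ̄ = pow γ Q
    δ = γ - γ̄

    δ≢0 : ¬ δ ≡ 0#
    δ≢0 δ≡0 = γ∉F (sym (x-y≡0⇒x≡y δ≡0))

    -- The Frobenius x ↦ x^Q fixes F and sends a + γ b to a + γ̄ b, which isolates b.
    v : Carrier → Carrier
    v x = (x - pow x Q) * δ ⁻¹

    u : Carrier → Carrier
    u x = x - γ * v x

    u+γv≡x : ∀ x → u x + γ * v x ≡ x
    u+γv≡x x = solve 3 (λ x g v → (x :- g :* v) :+ g :* v := x) refl x γ (v x)

    conjugate : ∀ {a b} → F a → F b → pow (a + γ * b) Q ≡ a + γ̄ * b
    conjugate {a} {b} a∈F b∈F = trans (additive-q^ t a (γ * b)) (cong₂ _+_ a∈F (trans (pow-distrib-* γ b Q) (cong (γ̄ *_) b∈F)))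

    v-coordinate : ∀ {a b} → F a → F b → v (a + γ * b) ≡ b
    v-coordinate {a} {b} a∈F b∈F = begin
      ((a + γ * b) - pow (a + γ * b) Q) * δ ⁻¹ ≡⟨ cong (λ z → ((a + γ * b) - z) * δ ⁻¹) (conjugate a∈F b∈F) ⟩
      ((a + γ * b) - (a + γ̄ * b)) * δ ⁻¹       ≡⟨ solve 5 (λ a b g g′ w → ((a :+ g :* b) :- (a :+ g′ :* b)) :* w := b :* ((g :- g′) :* w)) refl a b γ γ̄ (δ ⁻¹) ⟩
      b * (δ * δ ⁻¹)                           ≡⟨ cong (b *_) (inverseʳ δ δ≢0) ⟩
      b * 1#                                   ≡⟨ *-identityʳ b ⟩
      b                                        ∎

    u-coordinate : ∀ {a b} → F a → F b → u (a + γ * b) ≡ a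
    u-coordinate {a} {b} a∈F b∈F = trans (cong (λ z → (a + γ * b) - γ * z) (v-coordinate a∈F b∈F))
      (solve 3 (λ a g b → (a :+ g :* b) :- g :* b := a) refl a γ b)

    coordinates-injective : ∀ {a b a′ b′} → F a → F b → F a′ → F b′ → a + γ * b ≡ a′ + γ * b′ → a ≡ a′ × b ≡ b′
    coordinates-injective a∈F b∈F a′∈F b′∈F eq =
      trans (sym (u-coordinate a∈F b∈F)) (trans (cong u eq) (u-coordinate a′∈F b′∈F)) ,
      trans (sym (v-coordinate a∈F b∈F)) (trans (cong v eq) (v-coordinate a′∈F b′∈F))

    v-InSub : ∀ x → F (v x)
    v-InSub x = begin
      pow ((x - x̄) * δ ⁻¹) Q            ≡⟨ pow-distrib-* (x - x̄) (δ ⁻¹) Q ⟩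
      pow (x - x̄) Q * pow (δ ⁻¹) Q      ≡⟨ cong₂ _*_ (conjugate-sub x) (pow-⁻¹ Q δ≢0) ⟩
      (x̄ - x) * pow δ Q ⁻¹              ≡⟨ cong (λ z → (x̄ - x) * z ⁻¹) (trans (conjugate-sub γ) (solve 2 (λ a b → b :- a := :- (a :- b)) refl γ γ̄)) ⟩
      (x̄ - x) * (- δ) ⁻¹                ≡⟨ cong ((x̄ - x) *_) (-‿⁻¹ δ≢0) ⟩
      (x̄ - x) * - (δ ⁻¹)                ≡⟨ solve 3 (λ x x̄ w → (x̄ :- x) :* (:- w) := (x :- x̄) :* w) refl x x̄ (δ ⁻¹) ⟩
      (x - x̄) * δ ⁻¹                    ∎
      where
      x̄ = pow x Q
      conjugate-sub : ∀ y → pow (y - pow y Q) Q ≡ pow y Q - y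
      conjugate-sub y = trans (pow-sub Q (additive-q^ t) y (pow y Q)) (cong (λ z → pow y Q - z) (conjugate-involutive y))

    u-InSub : ∀ x → F (u x)
    u-InSub x = begin
      pow (x - γ * v x) Q                          ≡⟨ pow-sub Q (additive-q^ t) x (γ * v x) ⟩
      x̄ - pow (γ * v x) Q                          ≡⟨ cong (λ z → x̄ - z) (trans (pow-distrib-* γ (v x) Q) (cong (γ̄ *_) (v-InSub x))) ⟩
      x̄ - γ̄ * ((x - x̄) * w)                        ≡⟨ solve 5 (λ x x̄ g ḡ w → x̄ :- ḡ :* ((x :- x̄) :* w) := (x :- g :* ((x :- x̄) :* w)) :+ ((x̄ :- x) :- (x̄ :- x) :* ((g :- ḡ) :* w))) refl x x̄ γ γ̄ w ⟩
      u x + ((x̄ - x) - (x̄ - x) * (δ * w))           ≡⟨ cong (λ e → u x + ((x̄ - x) - (x̄ - x) * e)) (inverseʳ δ δ≢0) ⟩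
      u x + ((x̄ - x) - (x̄ - x) * 1#)                ≡⟨ cong (λ e → u x + ((x̄ - x) - e)) (*-identityʳ (x̄ - x)) ⟩
      u x + ((x̄ - x) - (x̄ - x))                     ≡⟨ cong (u x +_) (-‿inverseʳ (x̄ - x)) ⟩
      u x + 0#                                     ≡⟨ +-identityʳ (u x) ⟩
      u x                                          ∎
      where
      x̄ = pow x Q
      w = δ ⁻¹

    card-F : Card F (q ℕ.^ t)
    card-F = subst (Card F) (m*m≡n*n⇒m≡n (trans |F|²≡size (sym q^t*q^t≡size))) |F|
      where
      |F| = card-filter (λ x → pow x Q ≟ x) everything
      |F|²≡size : _ ≡ size
      |F|²≡size = card-unique (card-image (card-× |F| |F|) (λ (a , b) → a + γ * b)
        (λ (a∈F , b∈F) (a′∈F , b′∈F) eq → let a≡a′ , b≡b′ = coordinates-injective a∈F b∈F a′∈F b′∈F eq in cong₂ _,_ a≡a′ b≡b′)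
        (λ _ → tt) (λ {x} _ → (u x , v x) , (u-InSub x , v-InSub x) , sym (u+γv≡x x))) everything

module PointWeights (K : FiniteField) {q : ℕ} (q-primePower : IsPrimePower q)
  {t : ℕ} (1≤t : 1 ≤ t) (size≡q^[2t] : FiniteField.size K ≡ q ℕ.^ (2 ℕ.* t))
  (ξ : FiniteField.Carrier K) (ξ∉F : ¬ InSub K (q ℕ.^ t) ξ)
  (c : Fin t → FiniteField.Carrier K) (c∈F : ∀ i → InSub K (q ℕ.^ t) (c i)) where

  open FiniteField K
  open FieldProperties K
  open QuadraticExtension K q-primePower 1≤t size≡q^[2t]
  open Coordinates ξ ξ∉F
  open Dimension K q using (dimK⇒card; dimK²⇒card)
  open ≡-Reasoning

  f : Carrier → Carrier
  f = linPoly K q t c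

  f-linear : ∀ {l} u v → InSub K q l → f (l * u + v) ≡ l * f u + f v
  f-linear {l} u v l∈F_q = trans (sumF-cong t term) (sumF-linear t l _ _)
    where
    term : ∀ i → c i * pow (l * u + v) (q ℕ.^ toℕ i) ≡ l * (c i * pow u (q ℕ.^ toℕ i)) + c i * pow v (q ℕ.^ toℕ i)
    term i = begin
      c i * pow (l * u + v) m          ≡⟨ cong (c i *_) (additive-q^ (toℕ i) (l * u) v) ⟩
      c i * (pow (l * u) m + pow v m)  ≡⟨ cong (λ z → c i * (z + pow v m)) (trans (pow-distrib-* l u m) (cong (_* pow u m) (InSub-^ q (toℕ i) l∈F_q))) ⟩
      c i * (l * pow u m + pow v m)    ≡⟨ solve 4 (λ c l a b → c :* (l :* a :+ b) := l :* (c :* a) :+ c :* b) refl (c i) l (pow u m) (pow v m) ⟩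
      l * (c i * pow u m) + c i * pow v m ∎
      where m = q ℕ.^ toℕ i

  f-0 : f 0# ≡ 0#
  f-0 = x+x≈x⇒x≈0 (f 0#) (sym (begin
    f 0#                ≡⟨ cong f (trans (+-identityʳ (1# * 0#)) (zeroʳ 1#)) ⟨
    f (1# * 0# + 0#)    ≡⟨ f-linear 0# 0# (InSub-1 q) ⟩
    1# * f 0# + f 0#    ≡⟨ cong (_+ f 0#) (*-identityˡ (f 0#)) ⟩
    f 0# + f 0#         ∎))

  f-scale : ∀ {l} u → InSub K q l → f (l * u) ≡ l * f u
  f-scale {l} u l∈F_q = begin
    f (l * u)          ≡⟨ cong f (+-identityʳ (l * u)) ⟨
    f (l * u + 0#)     ≡⟨ f-linear u 0# l∈F_q ⟩
    l * f u + f 0#     ≡⟨ cong (l * f u +_) f-0 ⟩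
    l * f u + 0#       ≡⟨ +-identityʳ (l * f u) ⟩
    l * f u            ∎

  f-F : ∀ {u} → F u → F (f u)
  f-F u∈F = F-sumF (λ i → F-* (c∈F i) (InSub-pow (q ℕ.^ t) (q ℕ.^ toℕ i) u∈F))

  s : Carrier → Carrier
  s u = u + ξ * f u

  s-injective : ∀ {u u′} → F u → F u′ → s u ≡ s u′ → u ≡ u′
  s-injective u∈F u′∈F eq = proj₁ (coordinates-injective u∈F (f-F u∈F) u′∈F (f-F u′∈F) eq)

  S-0 : S K q t f ξ 0#
  S-0 = 0# , F-0 , sym (trans (cong (λ z → 0# + ξ * z) f-0) (trans (+-identityˡ _) (zeroʳ ξ)))

  S-linear : ∀ {l x x′} → InSub K q l → S K q t f ξ x → S K q t f ξ x′ → S K q t f ξ (l * x + x′)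
  S-linear {l} {x} {x′} l∈F_q (u , u∈F , x≡) (u′ , u′∈F , x′≡) =
    l * u + u′ , F-+ (F-* (F_q⊆F l∈F_q) u∈F) u′∈F , (begin
      l * x + x′                           ≡⟨ cong₂ (λ a b → l * a + b) x≡ x′≡ ⟩
      l * (u + ξ * f u) + (u′ + ξ * f u′)   ≡⟨ solve 6 (λ l u u′ x a b → l :* (u :+ x :* a) :+ (u′ :+ x :* b) := (l :* u :+ u′) :+ x :* (l :* a :+ b)) refl l u u′ ξ (f u) (f u′) ⟩
      (l * u + u′) + ξ * (l * f u + f u′)   ≡⟨ cong (λ z → (l * u + u′) + ξ * z) (f-linear u u′ l∈F_q) ⟨
      s (l * u + u′)                       ∎)

  u∘s≡id : ∀ {a} → F a → u (s a) ≡ a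
  u∘s≡id a∈F = u-coordinate a∈F (f-F a∈F)

  Im-0 : Im K q t f 0#
  Im-0 = 0# , F-0 , sym f-0

  Im-linear : ∀ {l y y′} → InSub K q l → Im K q t f y → Im K q t f y′ → Im K q t f (l * y + y′)
  Im-linear l∈F_q (u , u∈F , refl) (u′ , u′∈F , refl) = _ , F-+ (F-* (F_q⊆F l∈F_q) u∈F) u′∈F , sym (f-linear u u′ l∈F_q)

  card-Im : ∀ {d} → DimK K q (Im K q t f) d → Card (Im K q t f) (q ℕ.^ d)
  card-Im basis = dimK⇒card basis InSub-q-sub Im-0 Im-linear card-InSub-q

  module _ (α : Carrier) where

    W : Carrier × Carrier → Set
    W = WeightSpace K q t f ξ α

    W-y≡x*α : ∀ {x y} → W (x , y) → y ≡ x * α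
    W-y≡x*α (_ , _ , _ , refl , refl) = refl

    W-0 : W (0# , 0#)
    W-0 = S-0 , S-0 , 0# , refl , sym (zeroˡ α)

    W-linear : ∀ {l x x′ y y′} → InSub K q l → W (x , y) → W (x′ , y′) → W (l * x + x′ , l * y + y′)
    W-linear {l} l∈F_q (Sx , Sy , λ₁ , refl , refl) (Sx′ , Sy′ , λ₂ , refl , refl) =
      S-linear l∈F_q Sx Sx′ , S-linear l∈F_q Sy Sy′ , l * λ₁ + λ₂ , refl ,
      solve 4 (λ l a b α → l :* (a :* α) :+ b :* α := (l :* a :+ b) :* α) refl l λ₁ λ₂ α

    card-W : ∀ {w} → DimK² K q W w → Card W (q ℕ.^ w)
    card-W basis = dimK²⇒card basis InSub-q-sub W-0 W-linear card-InSub-q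

    weight-F_q : InSub K q α → ∀ {w} → DimK² K q W w → w ≡ t
    weight-F_q α∈F_q basis = m^n≡m^o⇒n≡o 1<q (card-unique (card-W basis)
      (card-image card-F (λ u → s u , s u * α) (λ u∈F u′∈F eq → s-injective u∈F u′∈F (cong proj₁ eq)) W-s onto))
      where
      W-s : ∀ {u} → F u → W (s u , s u * α)
      W-s {u} u∈F = (u , u∈F , refl) , (α * u , F-* (F_q⊆F α∈F_q) u∈F , s-α) , s u , refl , refl
        where
        s-α : s u * α ≡ s (α * u)
        s-α = trans (solve 4 (λ u x a α → (u :+ x :* a) :* α := α :* u :+ x :* (α :* a)) refl u ξ (f u) α)
                    (cong (λ z → α * u + ξ * z) (sym (f-scale u α∈F_q)))
      onto : ∀ {xy} → W xy → Σ Carrier λ u → F u × xy ≡ (s u , s u * α)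
      onto {x , y} w@((u , u∈F , refl) , _) = u , u∈F , cong (s u ,_) (W-y≡x*α w)

    module _ (α≢0 : ¬ α ≡ 0#) where

      private
        β = α ⁻¹

      Ker : Carrier → Set
      Ker = KerTwist K q t f β

      Ker-0 : Ker 0#
      Ker-0 = F-0 , (begin
        f (β * 0#) - β * f 0#   ≡⟨ cong₂ (λ a b → f a - β * b) (zeroʳ β) f-0 ⟩
        f 0# - β * 0#           ≡⟨ cong₂ (λ a b → a - b) f-0 (zeroʳ β) ⟩
        0# - 0#                 ≡⟨ -‿inverseʳ 0# ⟩
        0#                      ∎)

      Ker-linear : ∀ {l a a′} → InSub K q l → Ker a → Ker a′ → Ker (l * a + a′)
      Ker-linear {l} {a} {a′} l∈F_q (a∈F , Ka) (a′∈F , Ka′) = F-+ (F-* (F_q⊆F l∈F_q) a∈F) a′∈F , (begin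
        f (β * (l * a + a′)) - β * f (l * a + a′)
          ≡⟨ cong₂ (λ r z → f r - β * z) (solve 4 (λ b l a a′ → b :* (l :* a :+ a′) := l :* (b :* a) :+ b :* a′) refl β l a a′) (f-linear a a′ l∈F_q) ⟩
        f (l * (β * a) + β * a′) - β * (l * f a + f a′)
          ≡⟨ cong (λ z → z - β * (l * f a + f a′)) (f-linear (β * a) (β * a′) l∈F_q) ⟩
        (l * f (β * a) + f (β * a′)) - β * (l * f a + f a′)
          ≡⟨ solve 6 (λ l A B b A′ B′ → (l :* A :+ B) :- b :* (l :* A′ :+ B′) := l :* (A :- b :* A′) :+ (B :- b :* B′)) refl l (f (β * a)) (f (β * a′)) β (f a) (f a′) ⟩
        l * (f (β * a) - β * f a) + (f (β * a′) - β * f a′)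
          ≡⟨ cong₂ (λ r z → l * r + z) Ka Ka′ ⟩
        l * 0# + 0#
          ≡⟨ trans (+-identityʳ _) (zeroʳ l) ⟩
        0# ∎)

      card-Ker : ∀ {k} → DimK K q Ker k → Card Ker (q ℕ.^ k)
      card-Ker basis = dimK⇒card basis InSub-q-sub Ker-0 Ker-linear card-InSub-q

      weight-F : F α → ∀ {w k} → DimK² K q W w → DimK K q Ker k → w ≡ k
      weight-F α∈F basisW basisK = m^n≡m^o⇒n≡o 1<q (card-unique (card-W basisW)
        (card-image (card-Ker basisK) (λ z → s (β * z) , s z)
          (λ (z∈F , _) (z′∈F , _) eq → s-injective z∈F z′∈F (cong proj₂ eq)) W-image onto))
        where
        β[αx]≡x : ∀ x → β * (α * x) ≡ x
        β[αx]≡x x = x⁻¹*[x*y]≡y x α≢0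
        W-image : ∀ {z} → Ker z → W (s (β * z) , s z)
        W-image {z} (z∈F , Kz) = (β * z , F-* (InSub-⁻¹ (q ℕ.^ t) α≢0 α∈F) z∈F , refl) , (z , z∈F , refl) , s (β * z) , refl , sym (begin
          s (β * z) * α                       ≡⟨ cong (λ r → (β * z + ξ * r) * α) (x-y≡0⇒x≡y Kz) ⟩
          (β * z + ξ * (β * f z)) * α         ≡⟨ solve 5 (λ b z x a α → (b :* z :+ x :* (b :* a)) :* α := (b :* α) :* (z :+ x :* a)) refl β z ξ (f z) α ⟩
          (β * α) * s z                       ≡⟨ cong (_* s z) (x⁻¹*x≡1 α≢0) ⟩
          1# * s z                            ≡⟨ *-identityˡ (s z) ⟩
          s z                                 ∎)
        onto : ∀ {xy} → W xy → Σ Carrier λ z → Ker z × xy ≡ (s (β * z) , s z)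
        onto w@((u , u∈F , refl) , (v , v∈F , refl) , _) = v , (v∈F , Kv) , cong (_, s v) (cong s (sym βv≡u))
          where
          αu+ξαfu : s v ≡ α * u + ξ * (α * f u)
          αu+ξαfu = trans (W-y≡x*α w) (solve 4 (λ u x a α → (u :+ x :* a) :* α := α :* u :+ x :* (α :* a)) refl u ξ (f u) α)
          coordinates = coordinates-injective v∈F (f-F v∈F) (F-* α∈F u∈F) (F-* α∈F (f-F u∈F)) αu+ξαfu
          βv≡u : β * v ≡ u
          βv≡u = trans (cong (β *_) (proj₁ coordinates)) (β[αx]≡x u)
          Kv : f (β * v) - β * f v ≡ 0#
          Kv = begin
            f (β * v) - β * f v     ≡⟨ cong₂ (λ a b → f a - β * b) βv≡u (proj₂ coordinates) ⟩
            f u - β * (α * f u)     ≡⟨ cong (λ z → f u - z) (β[αx]≡x (f u)) ⟩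
            f u - f u               ≡⟨ -‿inverseʳ (f u) ⟩
            0#                      ∎

    weight-outside-F : ¬ F α → ∀ {w d} → DimK² K q W w → DimK K q (Im K q t f) d → w ≤ 2 ℕ.* d
    weight-outside-F α∉F {w} {d} basisW basisIm = subst (w ≤_) (cong (d ℕ.+_) (sym (ℕ.+-identityʳ d)))
      (m^n≤m^o⇒n≤o 1<q (subst (q ℕ.^ w ≤_) (sym (ℕ.^-distribˡ-+-* q d d))
        (card-injection (card-W basisW) (card-× (card-Im basisIm) (card-Im basisIm))
          (λ (x , y) → f (u x) , f (u y)) (λ {(x , y)} _ → (u x , u-InSub x , refl) , (u y , u-InSub y , refl)) injective)))
      where
      module α-Coordinates = Coordinates α α∉F
      -- Equal images give b − b′ = α (a − a′) with a, a′, b, b′ ∈ F, and α ∉ F forces a = a′, b = b′.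
      injective : ∀ {xy xy′} → W xy → W xy′ → (f (u (proj₁ xy)) , f (u (proj₂ xy))) ≡ (f (u (proj₁ xy′)) , f (u (proj₂ xy′))) → xy ≡ xy′
      injective w@((a , a∈F , refl) , (b , b∈F , refl) , _) w′@((a′ , a′∈F , refl) , (b′ , b′∈F , refl) , _) eq =
        cong₂ (λ a b → s a , s b) (sym (proj₂ coordinates)) (proj₁ coordinates)
        where
        fa≡fa′ : f a ≡ f a′
        fa≡fa′ = trans (cong f (sym (u∘s≡id a∈F))) (trans (cong proj₁ eq) (cong f (u∘s≡id a′∈F)))
        fb≡fb′ : f b ≡ f b′
        fb≡fb′ = trans (cong f (sym (u∘s≡id b∈F))) (trans (cong proj₂ eq) (cong f (u∘s≡id b′∈F)))
        sb′≡[a′+ξfa]α : b′ + ξ * f b ≡ (a′ + ξ * f a) * α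
        sb′≡[a′+ξfa]α = trans (cong (λ z → b′ + ξ * z) fb≡fb′)
          (trans (W-y≡x*α w′) (cong (λ z → (a′ + ξ * z) * α) (sym fa≡fa′)))
        b+αa′≡b′+αa : b + α * a′ ≡ b′ + α * a
        b+αa′≡b′+αa = x-y≡0⇒x≡y (begin
          (b + α * a′) - (b′ + α * a)
            ≡⟨ solve 8 (λ b b′ a a′ x A B α → (b :+ α :* a′) :- (b′ :+ α :* a) := ((b :+ x :* B) :- (b′ :+ x :* B)) :- ((a :+ x :* A) :* α :- (a′ :+ x :* A) :* α)) refl b b′ a a′ ξ (f a) (f b) α ⟩
          ((b + ξ * f b) - (b′ + ξ * f b)) - ((a + ξ * f a) * α - (a′ + ξ * f a) * α)
            ≡⟨ cong₂ (λ r z → (r - z) - ((a + ξ * f a) * α - (a′ + ξ * f a) * α)) (W-y≡x*α w) sb′≡[a′+ξfa]α ⟩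
          ((a + ξ * f a) * α - (a′ + ξ * f a) * α) - ((a + ξ * f a) * α - (a′ + ξ * f a) * α)
            ≡⟨ -‿inverseʳ _ ⟩
          0# ∎)
        coordinates = α-Coordinates.coordinates-injective b∈F a′∈F b′∈F a∈F b+αa′≡b′+αa

proposition4p7 :
    (q t : ℕ) → IsPrimePower q → 1 ≤ t →
    (K : FiniteField) → FiniteField.size K ≡ q ℕ.^ (2 ℕ.* t) →
    (ξ : FiniteField.Carrier K) → ¬ InSub K (q ℕ.^ t) ξ →
    (c : Fin t → FiniteField.Carrier K) → (∀ i → InSub K (q ℕ.^ t) (c i)) →
    (α : FiniteField.Carrier K) → ¬ (α ≡ FiniteField.0# K) →
    ((¬ InSub K (q ℕ.^ t) α) →
       ∀ w d → DimK² K q (WeightSpace K q t (linPoly K q t c) ξ α) w →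
         DimK K q (Im K q t (linPoly K q t c)) d → w ≤ 3 ℕ.* d)
    × (InSub K (q ℕ.^ t) α → ¬ InSub K q α →
       ∀ w k → DimK² K q (WeightSpace K q t (linPoly K q t c) ξ α) w →
         DimK K q (KerTwist K q t (linPoly K q t c) (FiniteField._⁻¹ K α)) k → w ≡ k)
    × (InSub K q α →
       ∀ w → DimK² K q (WeightSpace K q t (linPoly K q t c) ξ α) w → w ≡ t)
proposition4p7 q t q-primePower 1≤t K size≡q^[2t] ξ ξ∉F c c∈F α α≢0 =
  (λ α∉F w d basisW basisIm → ℕ.≤-trans (weight-outside-F α α∉F basisW basisIm) (ℕ.*-monoˡ-≤ d (ℕ.n≤1+n 2))) ,
  (λ α∈F _ w k basisW basisKer → weight-F α α≢0 α∈F basisW basisKer) ,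
  (λ α∈F_q w basisW → weight-F_q α α∈F_q basisW)
  where open PointWeights K q-primePower 1≤t size≡q^[2t] ξ ξ∉F c c∈F
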